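{- Let $n\ge1$ and $0\le k\le n-1$ be integers, $N=2n-k$, and let $\pi$ be the bijection described in the context from $\mathrm{Inc}^k(2\times n)$ to noncrossing partitions of $\{1,\dots,N\}$ into $n-k$ blocks of size at least $2$. Then for every $T\in\mathrm{Inc}^k(2\times n)$, $\pi(\mathcal{P}(T))=\mathcal{R}(\pi(T))$.
   Context: Partitions are identified with Young diagrams in English convention; $|\lambda|$ is the number of boxes; $2\times n$ is the partition $(n,n)$. An increasing tableau of shape $\lambda$ is a filling of the boxes of $\lambda$ by positive integers, strictly increasing along rows and down columns, whose set of entries is $\{1,\dots,M\}$ for some $M$. $\mathrm{Inc}^k(\lambda)$ is the set of increasing tableaux of shape $\lambda$ with maximum entry $|\lambda|-k$. K-promotion: the SE-neighbors of a box are the (at most two) boxes of the shape immediately below it or immediately to its right. For an increasing tableau $T$ with maximum entry $M$, delete the entry $1$, leaving an empty box; then repeatedly, simultaneously on all empty boxes, until no empty box has an SE-neighbor: label each empty box by the minimal label among its SE-neighbors and remove that label from the SE-neighbor(s) in which it appears (an empty box with no SE-neighbor is left unchanged). Finally label all empty boxes by $M+1$ and subtract $1$ from every label; the result is $\mathcal{P}(T)$. The map $\pi$: process the entries $i$ of row 2 of $T$ in increasing order and let $s_i$ be the largest entry of row 1 that is less than $i$ and not equal to $s_j$ for any processed $j<i$; $\pi(T)$ is the set partition of $\{1,\dots,N\}$ generated by putting $i$ and $s_i$ in the same block for each $i$ in row 2. A set partition is noncrossing if there are no $a<b<c<d$ with $a,c$ in one block and $b,d$ in another. For a set partition $\Pi$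 of $\{1,\dots,N\}$, $\mathcal{R}(\Pi)$ is the partition obtained by replacing each element $i\ge2$ by $i-1$ and the element $1$ by $N$ (rotation of the circular picture, with $1,\dots,N$ placed counterclockwise, clockwise by $2\pi/N$). -}

module Defs where

open import Data.Nat using (ℕ; zero; suc; _+_; _*_; _∸_; _≤_; _<_; _⊔_; _≡ᵇ_; _<ᵇ_)
open import Data.Bool using (Bool; true; false; if_then_else_; _∧_; not)
open import Data.Fin using (Fin; zero; suc; toℕ)
open import Data.List using (List; []; _∷_; map; filter; foldr; concatMap; allFin)
open import Data.Bool.ListAction using (any)
open import Data.Maybe using (Maybe; just; nothing)
import Data.Maybe as Maybe
open import Data.Product using (_×_; _,_; Σ; ∃)
open import Relation.Binary.PropositionalEquality using (_≡_)
open import Data.List.Membership.Propositional using (_∈_)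
open import Function.Bundles using (_⇔_)

-- A box is (r , c) with r : Fin 2 (row, 0 = top) and c : Fin n (column,
-- 0 = left).  Labels are natural numbers; during K-promotion the label
-- 0 is used to denote an EMPTY box (genuine labels are always ≥ 1).

Tab : ℕ → Set
Tab n = Fin 2 → Fin n → ℕ

Box : ℕ → Set
Box n = Fin 2 × Fin n

record IsIncreasingWithMax (n M : ℕ) (T : Tab n) : Set where
  field
    positive  : ∀ r c → 1 ≤ T r c
    rowStrict : ∀ r (c c' : Fin n) → toℕ c < toℕ c' → T r c < T r c'
    colStrict : ∀ c → T zero c < T (suc zero) c
    bounded   : ∀ r c → T r c ≤ M
    surjective : ∀ v → 1 ≤ v → v ≤ M → ∃ λ (b : Box n) → T (Data.Product.proj₁ b) (Data.Product.proj₂ b) ≡ v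

InInc : (n k : ℕ) → Tab n → Set
InInc n k T = IsIncreasingWithMax n (2 * n ∸ k) T

nextCol : ∀ {n} → Fin n → Maybe (Fin n)
nextCol {suc zero} zero = nothing
nextCol {suc (suc n)} zero = just (suc zero)
nextCol {suc (suc n)} (suc c) = Maybe.map suc (nextCol c)

prevCol : ∀ {n} → Fin n → Maybe (Fin n)
prevCol zero = nothing
prevCol (suc zero) = just zero
prevCol (suc (suc c)) = Maybe.map suc (prevCol (suc c))

maybeToList : ∀ {A : Set} → Maybe A → List A
maybeToList nothing = []
maybeToList (just x) = x ∷ []

seNbrs : ∀ {n} → Box n → List (Box n)
seNbrs (zero , c) = map (λ c' → (zero , c')) (maybeToList (nextCol c)) Data.List.++ ((suc zero , c) ∷ [])
seNbrs (suc r , c) = map (λ c' → (suc r , c')) (maybeToList (nextCol c))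

nwNbrs : ∀ {n} → Box n → List (Box n)
nwNbrs (zero , c) = map (λ c' → (zero , c')) (maybeToList (prevCol c))
nwNbrs (suc r , c) = map (λ c' → (suc r , c')) (maybeToList (prevCol c)) Data.List.++ ((zero , c) ∷ [])

at : ∀ {n} → Tab n → Box n → ℕ
at T (r , c) = T r c

isEmpty : ℕ → Bool
isEmpty v = v ≡ᵇ 0

minList : List ℕ → Maybe ℕ
minList [] = nothing
minList (x ∷ xs) with minList xs
... | nothing = just x
... | just m = just (if x <ᵇ m then x else m)

minSE : ∀ {n} → Tab n → Box n → Maybe ℕ
minSE T b = minList (filter (λ v → Data.Bool._≟_ (isEmpty v) false) (map (at T) (seNbrs b)))

eqMaybe : Maybe ℕ → ℕ → Bool
eqMaybe nothing v = false
eqMaybe (just m) v = m ≡ᵇ v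

-- One simultaneous step of K-promotion: every empty box with an
-- SE-neighbour receives the minimal label m among its SE-neighbours,
-- and m is removed (the box emptied) from the SE-neighbour(s) where it
-- appears.
kStep : ∀ {n} → Tab n → Tab n
kStep T r c with isEmpty (T r c)
... | true  with minSE T (r , c)
...   | nothing = 0
...   | just m  = m
kStep T r c | false =
  if any (λ b' → isEmpty (at T b') ∧ eqMaybe (minSE T b') (T r c)) (nwNbrs (r , c))
  then 0 else T r c

iterate : ∀ {A : Set} → ℕ → (A → A) → A → A
iterate zero f x = x
iterate (suc k) f x = iterate k f (f x)

maxEntry : ∀ {n} → Tab n → ℕ
maxEntry {n} T = foldr _⊔_ 0 (map (λ c → T zero c ⊔ T (suc zero) c) (allFin n))

-- The sliding step is iterated n + 1 times: each step
-- moves every empty box to an SE-neighbour (increasing row+column by 1,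
-- which is at most n), and once no empty box has an SE-neighbour kStep
-- is the identity, so this is exactly "repeat until no empty box has an
-- SE-neighbour".
kPro : ∀ {n} → Tab n → Tab n
kPro {n} T r c =
  let M  = maxEntry T
      T₀ : Tab _
      T₀ = λ r' c' → if T r' c' ≡ᵇ 1 then 0 else T r' c'
      T₁ = iterate (suc n) kStep T₀
      v  = T₁ r c
  in if isEmpty v then M else v ∸ 1

row : ∀ {n} → Tab n → Fin 2 → List ℕ
row {n} T r = map (T r) (allFin n)

elem : ℕ → List ℕ → Bool
elem x xs = any (λ y → x ≡ᵇ y) xs

maxList : List ℕ → Maybe ℕ
maxList [] = nothing
maxList (x ∷ xs) with maxList xs
... | nothing = just x
... | just m = just (x ⊔ m)

chooseS : List ℕ → List ℕ → ℕ → Maybe ℕ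
chooseS row1 used i = maxList (filter (λ a → Data.Bool._≟_ ((a <ᵇ i) ∧ not (elem a used)) true) row1)

pairsGo : List ℕ → List ℕ → List ℕ → List (ℕ × ℕ)
pairsGo row1 used [] = []
pairsGo row1 used (i ∷ is) with chooseS row1 used i
... | nothing = pairsGo row1 used is
... | just s  = (i , s) ∷ pairsGo row1 (s ∷ used) is

insertSorted : ℕ → List ℕ → List ℕ
insertSorted x [] = x ∷ []
insertSorted x (y ∷ ys) = if y <ᵇ x then y ∷ insertSorted x ys else x ∷ y ∷ ys

sortℕ : List ℕ → List ℕ
sortℕ = foldr insertSorted []

piPairs : ∀ {n} → Tab n → List (ℕ × ℕ)
piPairs T = pairsGo (row T zero) [] (sortℕ (row T (suc zero)))

data Gen (E : List (ℕ × ℕ)) : ℕ → ℕ → Set where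
  gen-refl  : ∀ {i} → Gen E i i
  gen-edge  : ∀ {i j} → (i , j) ∈ E → Gen E i j
  gen-sym   : ∀ {i j} → Gen E i j → Gen E j i
  gen-trans : ∀ {i j l} → Gen E i j → Gen E j l → Gen E i l

-- Set partitions of {1,…,N}, represented by their equivalence relation
-- "i and j lie in the same block" (only its restriction to {1,…,N}
-- matters).

SetPartition : Set₁
SetPartition = ℕ → ℕ → Set

piMap : ∀ {n} → Tab n → SetPartition
piMap T = Gen (piPairs T)

-- preimage of i under the relabelling i ↦ i − 1 (i ≥ 2), 1 ↦ N
rotPre : ℕ → ℕ → ℕ
rotPre N i = if i <ᵇ N then suc i else 1

rotR : ℕ → SetPartition → SetPartition
rotR N Π i j = Π (rotPre N i) (rotPre N j)

SamePartition : ℕ → SetPartition → SetPartition → Set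
SamePartition N Π Π' = ∀ i j → 1 ≤ i → i ≤ N → 1 ≤ j → j ≤ N → (Π i j ⇔ Π' i j)

module Submission where

-- Let T have rows a₀ < … < a_m (a₀ = 1) and b₀ < … < b_m, N = 2n − k.
-- K-promotion is governed by two break columns (Breaks): D, the first j with
-- b_j < a_{j+1}, and E ≤ D, the first j with b_j ≤ a_{j+1}.  The hole left by
-- deleting 1 slides along the top row to column D and drops onto b_D; at
-- column E it splits off a second hole sliding along the bottom row.
-- The module Pairing then runs the greedy pairing of π on T and on 𝒫(T)
-- (labels shifted by one) in lockstep, in three phases (columns < E, E … D,
-- > D): both emit the same pairs, except that T pairs b_E with 1, 𝒫(T)
-- pairs N + 1 with b_D, and the shared pairs link b_E to b_D.

open import Defs
open import Data.Nat using (ℕ; zero; suc; _+_; _*_; _∸_; _≤_; _<_; _⊔_; _≡ᵇ_; _<ᵇ_; z≤n; s≤s; pred)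
open import Data.Nat.Properties
open import Data.Bool using (Bool; true; false; if_then_else_; _∧_; not) renaming (_≟_ to _≟ᵇ_)
import Data.Bool as Bool
open import Data.Fin using (Fin; zero; suc; toℕ)
open import Data.Fin.Properties using (toℕ<n)
open import Data.List using (List; []; _∷_; map; filter; foldr; length; _++_; tabulate; allFin)
import Data.List.Properties as ListProps
open import Data.List.Membership.Propositional using (_∈_; _∉_)
open import Data.List.Membership.Propositional.Properties
  using (∈-filter⁻; ∈-filter⁺; ∈-∃++; ∈-allFin; ∈-map⁺; ∈-map⁻; ∈-++⁻; ∈-++⁺ˡ; ∈-++⁺ʳ)
open import Data.List.Membership.DecPropositional _≟_ using (_∈?_)
open import Data.List.Relation.Unary.All using (All; []; _∷_)
open import Data.List.Relation.Unary.Any using (Any; here; there)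
open import Data.Bool.ListAction using (any)
open import Data.Maybe using (Maybe; just; nothing)
import Data.Maybe as Maybe
open import Data.Product using (_×_; _,_; proj₁; proj₂; Σ)
open import Data.Sum using (_⊎_; inj₁; inj₂; [_,_]′)
open import Data.Empty using (⊥; ⊥-elim)
open import Data.Unit using (⊤; tt)
open import Relation.Nullary using (¬_; Dec; yes; no)
open import Relation.Binary.PropositionalEquality
open import Relation.Binary.Definitions using (tri<; tri≈; tri>)
open import Function.Bundles using (mk⇔)

true≢false : true ≢ false
true≢false ()

≡ᵇ-true⇒≡ : ∀ m n → (m ≡ᵇ n) ≡ true → m ≡ n
≡ᵇ-true⇒≡ m n e = ≡ᵇ⇒≡ m n (subst Bool.T (sym e) tt)

≡ᵇ-refl : ∀ m → (m ≡ᵇ m) ≡ true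
≡ᵇ-refl zero = refl
≡ᵇ-refl (suc m) = ≡ᵇ-refl m

≢⇒≡ᵇ-false : ∀ m n → m ≢ n → (m ≡ᵇ n) ≡ false
≢⇒≡ᵇ-false zero zero ne = ⊥-elim (ne refl)
≢⇒≡ᵇ-false zero (suc n) ne = refl
≢⇒≡ᵇ-false (suc m) zero ne = refl
≢⇒≡ᵇ-false (suc m) (suc n) ne = ≢⇒≡ᵇ-false m n (λ e → ne (cong suc e))

<ᵇ-true⇒< : ∀ m n → (m <ᵇ n) ≡ true → m < n
<ᵇ-true⇒< m n e = <ᵇ⇒< m n (subst Bool.T (sym e) tt)

<⇒<ᵇ-true : ∀ {m n} → m < n → (m <ᵇ n) ≡ true
<⇒<ᵇ-true {m} {n} p with m <ᵇ n | <⇒<ᵇ p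
... | true | _ = refl

≥⇒<ᵇ-false : ∀ {m n} → n ≤ m → (m <ᵇ n) ≡ false
≥⇒<ᵇ-false {m} {n} p with m <ᵇ n in eq
... | false = refl
... | true = ⊥-elim (<⇒≱ (<ᵇ-true⇒< m n eq) p)

<ᵇ-false⇒≥ : ∀ m n → (m <ᵇ n) ≡ false → n ≤ m
<ᵇ-false⇒≥ m n e = ≮⇒≥ (λ p → true≢false (trans (sym (<⇒<ᵇ-true p)) e))

min-left : ∀ {x y} → x ≤ y → (if x <ᵇ y then x else y) ≡ x
min-left {x} {y} p with m≤n⇒m<n∨m≡n p
... | inj₁ q rewrite <⇒<ᵇ-true q = refl
... | inj₂ refl rewrite ≥⇒<ᵇ-false {x} {x} ≤-refl = refl

min-right : ∀ {x y} → y ≤ x → (if x <ᵇ y then x else y) ≡ y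
min-right {x} {y} p rewrite ≥⇒<ᵇ-false {x} {y} p = refl

nonzero : ∀ {v} → 1 ≤ v → v ≢ 0
nonzero (s≤s p) ()

just-injective : ∀ {x y : ℕ} → just x ≡ just y → x ≡ y
just-injective refl = refl

elem⇒∈ : ∀ x xs → elem x xs ≡ true → x ∈ xs
elem⇒∈ x (y ∷ ys) e with x ≡ᵇ y in eq
... | true = here (≡ᵇ-true⇒≡ x y eq)
... | false = there (elem⇒∈ x ys e)

∈⇒elem : ∀ {x xs} → x ∈ xs → elem x xs ≡ true
∈⇒elem {x} (here refl) rewrite ≡ᵇ-refl x = refl
∈⇒elem {x} {y ∷ ys} (there p) with x ≡ᵇ y
... | true = refl
... | false = ∈⇒elem p

∉⇒elem-false : ∀ x xs → x ∉ xs → elem x xs ≡ false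
∉⇒elem-false x xs nx with elem x xs in eq
... | false = refl
... | true = ⊥-elim (nx (elem⇒∈ x xs eq))

maxList-nothing : ∀ xs → maxList xs ≡ nothing → xs ≡ []
maxList-nothing [] e = refl
maxList-nothing (x ∷ xs) e with maxList xs
maxList-nothing (x ∷ xs) () | nothing
maxList-nothing (x ∷ xs) () | just m

maxList-just : ∀ xs m → maxList xs ≡ just m → m ∈ xs × (∀ y → y ∈ xs → y ≤ m)
maxList-just [] m ()
maxList-just (x ∷ xs) m e with maxList xs in eq
maxList-just (x ∷ xs) .x refl | nothing rewrite maxList-nothing xs eq =
  here refl , λ { y (here refl) → ≤-refl }
maxList-just (x ∷ xs) .(x ⊔ m') refl | just m' with maxList-just xs m' eq
... | m'∈ , m'-max with ≤-total x m'
... | inj₁ x≤m' rewrite m≤n⇒m⊔n≡n x≤m' = there m'∈ ,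
  λ { y (here refl) → x≤m' ; y (there p) → m'-max y p }
... | inj₂ m'≤x rewrite m≥n⇒m⊔n≡m m'≤x = here refl ,
  λ { y (here refl) → ≤-refl ; y (there p) → ≤-trans (m'-max y p) m'≤x }

foldr⊔-upper : ∀ {x} xs → x ∈ xs → x ≤ foldr _⊔_ 0 xs
foldr⊔-upper (y ∷ ys) (here refl) = m≤m⊔n y _
foldr⊔-upper (y ∷ ys) (there p) = ≤-trans (foldr⊔-upper ys p) (m≤n⊔m y _)

foldr⊔-least : ∀ {M} xs → (∀ {x} → x ∈ xs → x ≤ M) → foldr _⊔_ 0 xs ≤ M
foldr⊔-least [] h = z≤n
foldr⊔-least (y ∷ ys) h = ⊔-lub (h (here refl)) (foldr⊔-least ys (λ p → h (there p)))

<-of-+suc : ∀ {c k x} → c + suc k ≡ x → c < x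
<-of-+suc {c} {k} refl = m<m+n c (s≤s z≤n)

≡-of-+0 : ∀ {c x} → c + 0 ≡ x → c ≡ x
≡-of-+0 {c} e = trans (sym (+-identityʳ c)) e

Distinct : List ℕ → Set
Distinct [] = ⊤
Distinct (x ∷ xs) = x ∉ xs × Distinct xs

pigeonhole : ∀ xs ys → Distinct xs → (∀ {x} → x ∈ xs → x ∈ ys) → length xs ≤ length ys
pigeonhole [] ys d h = z≤n
pigeonhole (x ∷ xs) ys (x∉xs , d) h with ∈-∃++ (h (here refl))
... | ys₁ , ys₂ , refl = subst (suc (length xs) ≤_) (sym (length-middle ys₁ ys₂))
   (s≤s (pigeonhole xs (ys₁ ++ ys₂) d (λ {z} z∈xs → drop-middle ys₁ ys₂ (h (there z∈xs)) λ { refl → x∉xs z∈xs })))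
  where
  length-middle : ∀ {v : ℕ} (ys zs : List ℕ) → length (ys ++ v ∷ zs) ≡ suc (length (ys ++ zs))
  length-middle [] zs = refl
  length-middle (y ∷ ys) zs = cong suc (length-middle ys zs)

  drop-middle : ∀ {v x : ℕ} (ys zs : List ℕ) → x ∈ ys ++ v ∷ zs → x ≢ v → x ∈ ys ++ zs
  drop-middle [] zs (here refl) ne = ⊥-elim (ne refl)
  drop-middle [] zs (there p) ne = p
  drop-middle (y ∷ ys) zs (here refl) ne = here refl
  drop-middle (y ∷ ys) zs (there p) ne = there (drop-middle ys zs p ne)

first-missing : ∀ (xs u : List ℕ) → (Σ ℕ λ x → x ∈ xs × x ∉ u) ⊎ (∀ {x} → x ∈ xs → x ∈ u)
first-missing [] u = inj₂ λ ()
first-missing (y ∷ ys) u with y ∈? u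
... | no y∉u = inj₁ (y , here refl , y∉u)
... | yes y∈u with first-missing ys u
...   | inj₁ (x , p , q) = inj₁ (x , there p , q)
...   | inj₂ h = inj₂ λ { (here refl) → y∈u ; (there p) → h p }

missing-element : ∀ S u → Distinct S → length u < length S → Σ ℕ λ x → x ∈ S × x ∉ u
missing-element S u dS lt with first-missing S u
... | inj₁ r = r
... | inj₂ h = ⊥-elim (<⇒≱ lt (pigeonhole S u dS h))

exhausts : ∀ S u → Distinct u → (∀ {x} → x ∈ u → x ∈ S) → length S ≤ length u → ∀ {x} → x ∈ S → x ∈ u
exhausts S u du u⊆S le {x} x∈S with x ∈? u
... | yes p = p
... | no x∉u = ⊥-elim (1+n≰n (≤-trans (pigeonhole (x ∷ u) S (x∉u , du) (λ { (here refl) → x∈S ; (there p) → u⊆S p })) le))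

seg : (ℕ → ℕ) → ℕ → ℕ → List ℕ
seg f i zero = []
seg f i (suc k) = f i ∷ seg f (suc i) k

seg-length : ∀ f i k → length (seg f i k) ≡ k
seg-length f i zero = refl
seg-length f i (suc k) = cong suc (seg-length f (suc i) k)

private
  tail-bound : ∀ {i k j} → j < suc i + k → j < i + suc k
  tail-bound {i} {k} {j} = subst (j <_) (sym (+-suc i k))

  head-bound : ∀ i k → i < i + suc k
  head-bound i k = m<m+n i (s≤s z≤n)

seg-∈⁻ : ∀ f i k {x} → x ∈ seg f i k → Σ ℕ λ j → i ≤ j × j < i + k × f j ≡ x
seg-∈⁻ f i (suc k) (here refl) = i , ≤-refl , head-bound i k , refl
seg-∈⁻ f i (suc k) (there p) with seg-∈⁻ f (suc i) k p
... | j , i<j , j<end , e = j , ≤-trans (n≤1+n i) i<j , tail-bound j<end , e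

seg-∈⁺ : ∀ f i k j → i ≤ j → j < i + k → f j ∈ seg f i k
seg-∈⁺ f i zero j i≤j j<end = ⊥-elim (<⇒≱ j<end (subst (_≤ j) (sym (+-identityʳ i)) i≤j))
seg-∈⁺ f i (suc k) j i≤j j<end with m≤n⇒m<n∨m≡n i≤j
... | inj₂ refl = here refl
... | inj₁ i<j = there (seg-∈⁺ f (suc i) k j i<j (subst (j <_) (+-suc i k) j<end))

seg-++ : ∀ f i j k → seg f i (j + k) ≡ seg f i j ++ seg f (i + j) k
seg-++ f i zero k = cong (λ z → seg f z k) (sym (+-identityʳ i))
seg-++ f i (suc j) k rewrite seg-++ f (suc i) j k | +-suc i j = refl

seg-shift : ∀ f g i k → (∀ j → i ≤ j → j < i + k → f j ≡ g (suc j)) → seg f i k ≡ seg g (suc i) k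
seg-shift f g i zero h = refl
seg-shift f g i (suc k) h = cong₂ _∷_ (h i ≤-refl (head-bound i k))
  (seg-shift f g (suc i) k (λ j i<j j<end → h j (≤-trans (n≤1+n i) i<j) (tail-bound j<end)))

seg-cong : ∀ f g i k → (∀ j → i ≤ j → j < i + k → f j ≡ g j) → seg f i k ≡ seg g i k
seg-cong f g i zero h = refl
seg-cong f g i (suc k) h = cong₂ _∷_ (h i ≤-refl (head-bound i k))
  (seg-cong f g (suc i) k (λ j i<j j<end → h j (≤-trans (n≤1+n i) i<j) (tail-bound j<end)))

seg-map-suc : ∀ f i k → map suc (seg f i k) ≡ seg (λ j → suc (f j)) i k
seg-map-suc f i zero = refl
seg-map-suc f i (suc k) = cong (suc (f i) ∷_) (seg-map-suc f (suc i) k)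

IncreasingOn : (ℕ → ℕ) → ℕ → ℕ → Set
IncreasingOn f i k = ∀ j j' → i ≤ j → j < j' → j' < i + k → f j < f j'

increasing-tail : ∀ f i k → IncreasingOn f i (suc k) → IncreasingOn f (suc i) k
increasing-tail f i k h j j' i<j j<j' j'<end = h j j' (≤-trans (n≤1+n i) i<j) j<j' (tail-bound j'<end)

increasing-head : ∀ f i k → IncreasingOn f i (suc k) → ∀ {y} → y ∈ seg f (suc i) k → f i < y
increasing-head f i k h p with seg-∈⁻ f (suc i) k p
... | j , i<j , j<end , refl = h i j ≤-refl i<j (tail-bound j<end)

seg-distinct : ∀ f i k → IncreasingOn f i k → Distinct (seg f i k)
seg-distinct f i zero h = tt
seg-distinct f i (suc k) h =
  (λ p → <-irrefl refl (increasing-head f i k h p)) , seg-distinct f (suc i) k (increasing-tail f i k h)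

sort-increasing : ∀ f i k → IncreasingOn f i k → sortℕ (seg f i k) ≡ seg f i k
sort-increasing f i zero h = refl
sort-increasing f i (suc k) h rewrite sort-increasing f (suc i) k (increasing-tail f i k h) =
  insert-below (f i) (seg f (suc i) k) (increasing-head f i k h)
  where
  insert-below : ∀ x ys → (∀ {y} → y ∈ ys → x < y) → insertSorted x ys ≡ x ∷ ys
  insert-below x [] below = refl
  insert-below x (y ∷ ys) below rewrite ≥⇒<ᵇ-false {y} {x} (<⇒≤ (below (here refl))) = refl

row-as-seg : ∀ {k} (f : Fin k → ℕ) g → (∀ x → f x ≡ g (toℕ x)) → map f (allFin k) ≡ seg g 0 k
row-as-seg f g h = trans (ListProps.map-tabulate (λ x → x) f) (tabulate-seg f g 0 h)
  where
  tabulate-seg : ∀ {k} (f : Fin k → ℕ) g i → (∀ x → f x ≡ g (i + toℕ x)) → tabulate f ≡ seg g i k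
  tabulate-seg {zero} f g i h = refl
  tabulate-seg {suc k} f g i h = cong₂ _∷_ (trans (h zero) (cong g (+-identityʳ i)))
     (tabulate-seg (λ x → f (suc x)) g (suc i) λ x → trans (h (suc x)) (cong g (+-suc i (toℕ x))))

Available : List ℕ → List ℕ → ℕ → ℕ → Set
Available r u i a = a ∈ r × a < i × a ∉ u

private
  available? : List ℕ → ℕ → ℕ → Bool
  available? u i a = (a <ᵇ i) ∧ not (elem a u)

  available?-sound : ∀ u i a → available? u i a ≡ true → a < i × a ∉ u
  available?-sound u i a e with a <ᵇ i in e₁ | elem a u in e₂
  ... | true | false = <ᵇ-true⇒< a i e₁ , λ a∈u → true≢false (trans (sym (∈⇒elem a∈u)) e₂)
  available?-sound u i a () | true | true
  available?-sound u i a () | false | _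

  available?-complete : ∀ u i a → a < i → a ∉ u → available? u i a ≡ true
  available?-complete u i a a<i a∉u rewrite <⇒<ᵇ-true a<i | ∉⇒elem-false a u a∉u = refl

  candidates : List ℕ → List ℕ → ℕ → List ℕ
  candidates r u i = filter (λ a → available? u i a ≟ᵇ true) r

  candidate⁺ : ∀ r u i {a} → Available r u i a → a ∈ candidates r u i
  candidate⁺ r u i (a∈r , a<i , a∉u) = ∈-filter⁺ (λ a → available? u i a ≟ᵇ true) a∈r (available?-complete u i _ a<i a∉u)

chooseS-just : ∀ r u i s → chooseS r u i ≡ just s → Available r u i s × (∀ a → Available r u i a → a ≤ s)
chooseS-just r u i s e with maxList-just _ s e
... | s∈ , s-max with ∈-filter⁻ (λ a → available? u i a ≟ᵇ true) {xs = r} s∈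
... | s∈r , ok with available?-sound u i s ok
... | s<i , s∉u = (s∈r , s<i , s∉u) , λ a av → s-max a (candidate⁺ r u i av)

chooseS-nothing : ∀ r u i → chooseS r u i ≡ nothing → ∀ a → ¬ Available r u i a
chooseS-nothing r u i e a av with candidate⁺ r u i av
... | p rewrite maxList-nothing (candidates r u i) e with p
... | ()

chooseS-max : ∀ r u i s → Available r u i s → (∀ a → Available r u i a → a ≤ s) → chooseS r u i ≡ just s
chooseS-max r u i s av s-max with chooseS r u i in eq
... | nothing = ⊥-elim (chooseS-nothing r u i eq s av)
... | just s' with chooseS-just r u i s' eq
... | av' , s'-max = cong just (≤-antisym (s-max s' av') (s'-max s av))

chooseS-none : ∀ r u i → (∀ a → ¬ Available r u i a) → chooseS r u i ≡ nothing
chooseS-none r u i h with chooseS r u i in eq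
... | nothing = refl
... | just s = ⊥-elim (h s (proj₁ (chooseS-just r u i s eq)))

chooseS-some : ∀ r u i a → Available r u i a → Σ ℕ λ s → chooseS r u i ≡ just s
chooseS-some r u i a av with chooseS r u i in eq
... | just s = s , refl
... | nothing = ⊥-elim (chooseS-nothing r u i eq a av)

pairsGo-step : ∀ r u i is s → chooseS r u i ≡ just s →
  pairsGo r u (i ∷ is) ≡ (i , s) ∷ pairsGo r (s ∷ u) is
pairsGo-step r u i is s e with chooseS r u i
pairsGo-step r u i is s refl | just .s = refl

pairsGo-∈ : ∀ r u is {i s} → (i , s) ∈ pairsGo r u is → i ∈ is × s ∈ r
pairsGo-∈ r u (i ∷ is) p with chooseS r u i in eq
... | nothing = let q = pairsGo-∈ r u is p in there (proj₁ q) , proj₂ q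
pairsGo-∈ r u (i ∷ is) (here refl) | just s = here refl , proj₁ (proj₁ (chooseS-just r u i s eq))
pairsGo-∈ r u (i ∷ is) (there p) | just s = let q = pairsGo-∈ r (s ∷ u) is p in there (proj₁ q) , proj₂ q

private
  ∈-map-suc⁻ : ∀ {y} xs → y ∈ map suc xs → Σ ℕ λ x → y ≡ suc x × x ∈ xs
  ∈-map-suc⁻ xs p with ∈-map⁻ suc p
  ... | x , x∈ , e = x , e , x∈

  ∈-map-suc : ∀ {x} xs → suc x ∈ map suc xs → x ∈ xs
  ∈-map-suc xs p with ∈-map-suc⁻ xs p
  ... | z , refl , q = q

chooseS-suc : ∀ r u i → chooseS (map suc r) (map suc u) (suc i) ≡ Maybe.map suc (chooseS r u i)
chooseS-suc r u i with chooseS r u i in eq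
... | just s with chooseS-just r u i s eq
... | (s∈r , s<i , s∉u) , s-max = chooseS-max _ _ _ (suc s)
   (∈-map⁺ suc s∈r , s≤s s<i , λ q → s∉u (∈-map-suc u q)) below
  where
  below : ∀ a → Available (map suc r) (map suc u) (suc i) a → a ≤ suc s
  below a (a∈ , a<i , a∉u) with ∈-map-suc⁻ r a∈
  ... | z , refl , z∈r = s≤s (s-max z (z∈r , ≤-pred a<i , λ q → a∉u (∈-map⁺ suc q)))
chooseS-suc r u i | nothing = chooseS-none _ _ _ none
  where
  none : ∀ a → ¬ Available (map suc r) (map suc u) (suc i) a
  none a (a∈ , a<i , a∉u) with ∈-map-suc⁻ r a∈
  ... | z , refl , z∈r = chooseS-nothing r u i eq z (z∈r , ≤-pred a<i , λ q → a∉u (∈-map⁺ suc q))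

shiftPair : ℕ × ℕ → ℕ × ℕ
shiftPair (x , y) = suc x , suc y

pairsGo-suc : ∀ r u is → pairsGo (map suc r) (map suc u) (map suc is) ≡ map shiftPair (pairsGo r u is)
pairsGo-suc r u [] = refl
pairsGo-suc r u (i ∷ is) with chooseS r u i | chooseS-suc r u i
... | nothing | e rewrite e = pairsGo-suc r u is
... | just s | e rewrite e = cong ((suc i , suc s) ∷_) (pairsGo-suc r (s ∷ u) is)

Gen-map : ∀ {E E'} (f : ℕ → ℕ) → (∀ x y → (x , y) ∈ E → Gen E' (f x) (f y)) →
  ∀ {i j} → Gen E i j → Gen E' (f i) (f j)
Gen-map f h gen-refl = gen-refl
Gen-map f h (gen-edge e) = h _ _ e
Gen-map f h (gen-sym g) = gen-sym (Gen-map f h g)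
Gen-map f h (gen-trans g g') = gen-trans (Gen-map f h g) (Gen-map f h g')

Gen-mono : ∀ {E E'} → (∀ {e} → e ∈ E → e ∈ E') → ∀ {i j} → Gen E i j → Gen E' i j
Gen-mono h = Gen-map (λ x → x) (λ x y e → gen-edge (h e))

Gen-unshift : ∀ {E u v} → Gen (map shiftPair E) u v → Gen E (pred u) (pred v)
Gen-unshift {E} = Gen-map pred unshift-edge
  where
  unshift-edge : ∀ x y → (x , y) ∈ map shiftPair E → Gen E (pred x) (pred y)
  unshift-edge x y p with ∈-map⁻ shiftPair p
  ... | (x' , y') , q , refl = gen-edge q

-- Before E we have a_{j+1} < b_j, and between E
-- and D we have a_{j+1} = b_j.

record Breaks (m : ℕ) (a b : ℕ → ℕ) (D E : ℕ) : Set where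
  field
    D≤m      : D ≤ m
    E≤D      : E ≤ D
    D-before : ∀ j → j < D → a (suc j) ≤ b j
    D-at     : D < m → b D < a (suc D)
    E-before : ∀ j → j < E → a (suc j) < b j
    E-at     : E < m → b E ≤ a (suc E)

  E≤m : E ≤ m
  E≤m = ≤-trans E≤D D≤m

firstIndex : (ℕ → Bool) → ℕ → ℕ → ℕ
firstIndex P i zero = i
firstIndex P i (suc k) = if P i then i else firstIndex P (suc i) k

firstIndex-≤ : ∀ P i k → firstIndex P i k ≤ i + k
firstIndex-≤ P i zero = ≤-reflexive (sym (+-identityʳ i))
firstIndex-≤ P i (suc k) with P i
... | true = m≤m+n i (suc k)
... | false = subst (firstIndex P (suc i) k ≤_) (sym (+-suc i k)) (firstIndex-≤ P (suc i) k)

firstIndex-before : ∀ P i k j → i ≤ j → j < firstIndex P i k → P j ≡ false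
firstIndex-before P i zero j i≤j j<f = ⊥-elim (<⇒≱ j<f i≤j)
firstIndex-before P i (suc k) j i≤j j<f with P i in e
... | true = ⊥-elim (<⇒≱ j<f i≤j)
... | false with m≤n⇒m<n∨m≡n i≤j
... | inj₁ i<j = firstIndex-before P (suc i) k j i<j j<f
... | inj₂ refl = e

firstIndex-at : ∀ P i k → firstIndex P i k < i + k → P (firstIndex P i k) ≡ true
firstIndex-at P i zero f<end = ⊥-elim (<-irrefl (sym (+-identityʳ i)) f<end)
firstIndex-at P i (suc k) f<end with P i in e
... | true = e
... | false = firstIndex-at P (suc i) k (subst (firstIndex P (suc i) k <_) (+-suc i k) f<end)

breaks : ∀ m (a b : ℕ → ℕ) → Σ ℕ λ D → Σ ℕ λ E → Breaks m a b D E
breaks m a b = D , E , record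
  { D≤m = firstIndex-≤ dropsAt 0 m
  ; E≤D = E≤D
  ; D-before = D-before
  ; D-at = λ D<m → <ᵇ-true⇒< _ _ (firstIndex-at dropsAt 0 m D<m)
  ; E-before = E-before
  ; E-at = λ E<m → <ᵇ-false⇒≥ _ _ (not-true _ (firstIndex-at splitsAt 0 m E<m)) }
  where
  dropsAt splitsAt : ℕ → Bool
  dropsAt j = b j <ᵇ a (suc j)
  splitsAt j = not (a (suc j) <ᵇ b j)
  D E : ℕ
  D = firstIndex dropsAt 0 m
  E = firstIndex splitsAt 0 m

  not-true : ∀ x → not x ≡ true → x ≡ false
  not-true false e = refl

  not-false : ∀ x → not x ≡ false → x ≡ true
  not-false true e = refl

  D-before : ∀ j → j < D → a (suc j) ≤ b j
  D-before j j<D = <ᵇ-false⇒≥ (b j) (a (suc j)) (firstIndex-before dropsAt 0 m j z≤n j<D)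

  E-before : ∀ j → j < E → a (suc j) < b j
  E-before j j<E = <ᵇ-true⇒< _ _ (not-false _ (firstIndex-before splitsAt 0 m j z≤n j<E))

  E≤D : E ≤ D
  E≤D with ≤-<-connex E D
  ... | inj₁ E≤D = E≤D
  ... | inj₂ D<E = ⊥-elim (<⇒≱ (<ᵇ-true⇒< _ _ (firstIndex-at dropsAt 0 m D<m)) (<⇒≤ (E-before D D<E)))
    where
    D<m : D < m
    D<m = <-≤-trans D<E (firstIndex-≤ splitsAt 0 m)

-- A filling of the 2 × n
-- shape is modelled by F : Fin 2 → ℕ → ℕ (only columns < n matter), and
-- slideStep n F is kStep rewritten for such fillings; kStep-as-slideStep
-- shows that the two agree.  This lets the simulation of K-promotion work
-- with arithmetic on column indices instead of Fin-valued neighbours.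

Filling : Set
Filling = Fin 2 → ℕ → ℕ

rightLabel : ℕ → Filling → Fin 2 → ℕ → List ℕ
rightLabel n F r j = if suc j <ᵇ n then F r (suc j) ∷ [] else []

seLabels : ℕ → Filling → Fin 2 → ℕ → List ℕ
seLabels n F zero j = rightLabel n F zero j ++ (F (suc zero) j ∷ [])
seLabels n F (suc r) j = rightLabel n F (suc r) j

minSEℕ : ℕ → Filling → Fin 2 → ℕ → Maybe ℕ
minSEℕ n F r j = minList (filter (λ v → isEmpty v ≟ᵇ false) (seLabels n F r j))

nwBoxes : Fin 2 → ℕ → List (Fin 2 × ℕ)
nwBoxes zero zero = []
nwBoxes zero (suc j) = (zero , j) ∷ []
nwBoxes (suc r) zero = (zero , 0) ∷ []
nwBoxes (suc r) (suc j) = (suc r , j) ∷ (zero , suc j) ∷ []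

orZero : Maybe ℕ → ℕ
orZero nothing = 0
orZero (just v) = v

slideStep : ℕ → Filling → Fin 2 → ℕ → ℕ
slideStep n F r j = if isEmpty (F r j) then orZero (minSEℕ n F r j)
   else (if any (λ b → isEmpty (F (proj₁ b) (proj₂ b)) ∧ eqMaybe (minSEℕ n F (proj₁ b) (proj₂ b)) (F r j)) (nwBoxes r j)
         then 0 else F r j)

data NextCol {n} (x : Fin n) : Set where
  next-just : (x' : Fin n) → nextCol x ≡ just x' → toℕ x' ≡ suc (toℕ x) → NextCol x
  next-none : nextCol x ≡ nothing → suc (toℕ x) ≡ n → NextCol x

nextCol-view : ∀ {n} (x : Fin n) → NextCol x
nextCol-view {suc zero} zero = next-none refl refl
nextCol-view {suc (suc n)} zero = next-just (suc zero) refl refl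
nextCol-view {suc (suc n)} (suc x) with nextCol-view x
... | next-just x' e t = next-just (suc x') (cong (Maybe.map suc) e) (cong suc t)
... | next-none e t = next-none (cong (Maybe.map suc) e) (cong suc t)

data PrevCol {n} (x : Fin n) : Set where
  prev-just : (x' : Fin n) → prevCol x ≡ just x' → suc (toℕ x') ≡ toℕ x → PrevCol x
  prev-none : prevCol x ≡ nothing → toℕ x ≡ 0 → PrevCol x

prevCol-view : ∀ {n} (x : Fin n) → PrevCol x
prevCol-view zero = prev-none refl refl
prevCol-view (suc zero) = prev-just zero refl refl
prevCol-view (suc (suc x)) with prevCol-view (suc x)
... | prev-just x' e t = prev-just (suc x') (cong (Maybe.map suc) e) (cong suc t)
... | prev-none e ()

module _ {n : ℕ} (S : Tab n) (F : Filling) (S≗F : ∀ r x → S r x ≡ F r (toℕ x)) where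

  private
    rightLabel-eq : ∀ r (x : Fin n) → map (at S) (map (λ c' → (r , c')) (maybeToList (nextCol x))) ≡ rightLabel n F r (toℕ x)
    rightLabel-eq r x with nextCol-view x
    ... | next-just x' e t rewrite e | <⇒<ᵇ-true (subst (_< n) t (toℕ<n x')) | S≗F r x' | t = refl
    ... | next-none e t rewrite e | ≥⇒<ᵇ-false {suc (toℕ x)} {n} (≤-reflexive (sym t)) = refl

    seLabels-eq : ∀ r (x : Fin n) → map (at S) (seNbrs (r , x)) ≡ seLabels n F r (toℕ x)
    seLabels-eq zero x rewrite ListProps.map-++ (at S) (map (λ c' → (zero , c')) (maybeToList (nextCol x))) ((suc zero , x) ∷ [])
      | rightLabel-eq zero x | S≗F (suc zero) x = refl
    seLabels-eq (suc zero) x = rightLabel-eq (suc zero) x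

    minSE-eq : ∀ r (x : Fin n) → minSE S (r , x) ≡ minSEℕ n F r (toℕ x)
    minSE-eq r x = cong (λ l → minList (filter (λ v → isEmpty v ≟ᵇ false) l)) (seLabels-eq r x)

    kStep-empty : ∀ r x → isEmpty (S r x) ≡ true → kStep S r x ≡ orZero (minSE S (r , x))
    kStep-empty r x e with isEmpty (S r x)
    kStep-empty r x refl | true with minSE S (r , x)
    ... | nothing = refl
    ... | just m = refl

    kStep-full : ∀ r x → isEmpty (S r x) ≡ false → kStep S r x ≡
       (if any (λ b' → isEmpty (at S b') ∧ eqMaybe (minSE S b') (S r x)) (nwNbrs (r , x)) then 0 else S r x)
    kStep-full r x e with isEmpty (S r x)
    kStep-full r x refl | false = refl

    takes : ℕ → Fin 2 × ℕ → Bool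
    takes v b = isEmpty (F (proj₁ b) (proj₂ b)) ∧ eqMaybe (minSEℕ n F (proj₁ b) (proj₂ b)) v

    takes-eq : ∀ r x (b : Box n) → (isEmpty (at S b) ∧ eqMaybe (minSE S b) (S r x)) ≡ takes (S r x) (proj₁ b , toℕ (proj₂ b))
    takes-eq r x (r' , x') rewrite S≗F r' x' | minSE-eq r' x' = refl

    any-eq : ∀ r x → any (λ b' → isEmpty (at S b') ∧ eqMaybe (minSE S b') (S r x)) (nwNbrs (r , x))
                   ≡ any (takes (S r x)) (nwBoxes r (toℕ x))
    any-eq zero x with prevCol-view x
    ... | prev-just x' e t rewrite e | sym t | takes-eq zero x (zero , x') = refl
    ... | prev-none e t rewrite e | t = refl
    any-eq (suc zero) x with prevCol-view x
    ... | prev-just x' e t rewrite e | sym t | takes-eq (suc zero) x (suc zero , x') | takes-eq (suc zero) x (zero , x) | sym t = refl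
    ... | prev-none e t rewrite e | takes-eq (suc zero) x (zero , x) | t = refl

  kStep-as-slideStep : ∀ r x → kStep S r x ≡ slideStep n F r (toℕ x)
  kStep-as-slideStep r x = by-emptiness (isEmpty (S r x)) refl
    where
    by-emptiness : ∀ e → isEmpty (S r x) ≡ e → kStep S r x ≡ slideStep n F r (toℕ x)
    by-emptiness true e rewrite kStep-empty r x e | minSE-eq r x | sym (S≗F r x) | e = refl
    by-emptiness false e rewrite kStep-full r x e | any-eq r x | sym (S≗F r x) | e = refl

module _ (n : ℕ) (F : Filling) where

  NotTaking : ℕ → Fin 2 × ℕ → Set
  NotTaking v b = F (proj₁ b) (proj₂ b) ≢ 0 ⊎ (∀ w → minSEℕ n F (proj₁ b) (proj₂ b) ≡ just w → w ≢ v)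

  Taking : ℕ → Fin 2 × ℕ → Set
  Taking v b = F (proj₁ b) (proj₂ b) ≡ 0 × minSEℕ n F (proj₁ b) (proj₂ b) ≡ just v

  private
    test : ℕ → Fin 2 × ℕ → Bool
    test v b = isEmpty (F (proj₁ b) (proj₂ b)) ∧ eqMaybe (minSEℕ n F (proj₁ b) (proj₂ b)) v

    test-false : ∀ v b → NotTaking v b → test v b ≡ false
    test-false v (r , j) (inj₁ F≢0) rewrite ≢⇒≡ᵇ-false (F r j) 0 F≢0 = refl
    test-false v (r , j) (inj₂ h) with F r j ≡ᵇ 0
    ... | false = refl
    ... | true with minSEℕ n F r j in e
    ... | nothing = refl
    ... | just w = ≢⇒≡ᵇ-false w v (h w refl)

    any-false : ∀ v bs → All (NotTaking v) bs → any (test v) bs ≡ false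
    any-false v [] [] = refl
    any-false v (b ∷ bs) (p ∷ ps) rewrite test-false v b p = any-false v bs ps

    any-true : ∀ v bs → Any (Taking v) bs → any (test v) bs ≡ true
    any-true v ((r , j) ∷ bs) (here (F≡0 , e)) rewrite F≡0 | e | ≡ᵇ-refl v = refl
    any-true v (b ∷ bs) (there p) rewrite any-true v bs p with test v b
    ... | true = refl
    ... | false = refl

  slide-keep : ∀ r j → F r j ≢ 0 → All (NotTaking (F r j)) (nwBoxes r j) → slideStep n F r j ≡ F r j
  slide-keep r j F≢0 none rewrite ≢⇒≡ᵇ-false (F r j) 0 F≢0 | any-false (F r j) (nwBoxes r j) none = refl

  slide-kill : ∀ r j → F r j ≢ 0 → Any (Taking (F r j)) (nwBoxes r j) → slideStep n F r j ≡ 0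
  slide-kill r j F≢0 some rewrite ≢⇒≡ᵇ-false (F r j) 0 F≢0 | any-true (F r j) (nwBoxes r j) some = refl

  slide-fill : ∀ r j → F r j ≡ 0 → slideStep n F r j ≡ orZero (minSEℕ n F r j)
  slide-fill r j F≡0 rewrite F≡0 = refl

  minSE-top : ∀ j x y → suc j < n → F zero (suc j) ≡ x → F (suc zero) j ≡ y → x ≢ 0 → y ≢ 0 →
    minSEℕ n F zero j ≡ just (if x <ᵇ y then x else y)
  minSE-top j x y lt ex ey x≢0 y≢0 rewrite <⇒<ᵇ-true lt | ex | ey | ≢⇒≡ᵇ-false x 0 x≢0 | ≢⇒≡ᵇ-false y 0 y≢0 = refl

  minSE-top-last : ∀ j y → n ≤ suc j → F (suc zero) j ≡ y → y ≢ 0 → minSEℕ n F zero j ≡ just y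
  minSE-top-last j y le ey y≢0 rewrite ≥⇒<ᵇ-false {suc j} {n} le | ey | ≢⇒≡ᵇ-false y 0 y≢0 = refl

  minSE-bottom : ∀ j y → suc j < n → F (suc zero) (suc j) ≡ y → y ≢ 0 → minSEℕ n F (suc zero) j ≡ just y
  minSE-bottom j y lt ey y≢0 rewrite <⇒<ᵇ-true lt | ey | ≢⇒≡ᵇ-false y 0 y≢0 = refl

  minSE-bottom-last : ∀ j → n ≤ suc j → minSEℕ n F (suc zero) j ≡ nothing
  minSE-bottom-last j le rewrite ≥⇒<ᵇ-false {suc j} {n} le = refl

all-nw-top : ∀ {P : Fin 2 × ℕ → Set} j → (∀ j' → j ≡ suc j' → P (zero , j')) → All P (nwBoxes zero j)
all-nw-top zero h = []
all-nw-top (suc j) h = h j refl ∷ []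

all-nw-bottom : ∀ {P : Fin 2 × ℕ → Set} j → P (zero , j) → (∀ j' → j ≡ suc j' → P (suc zero , j')) →
  All P (nwBoxes (suc zero) j)
all-nw-bottom zero above h = above ∷ []
all-nw-bottom (suc j) above h = h j refl ∷ above ∷ []

any-nw-above : ∀ {P : Fin 2 × ℕ → Set} j → P (zero , j) → Any P (nwBoxes (suc zero) j)
any-nw-above zero above = here above
any-nw-above (suc j) above = there (here above)

-- StT t / StB t give the top and
-- bottom rows after t sliding steps (0 marks a hole):
--   top row, t ≤ D:  a₁ … a_t  ·  hole  ·  a_{t+1} … a_m
--   top row, t > D:  a₁ … a_D  ·  b_D   ·  a_{D+1} … a_m
--   bottom row, t ≤ E: unchanged;  t > E: b₀ … b_{E−1} · b_{E+1} … b_{t−1} · hole · b_t … b_m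
-- slide-top and slide-bottom show that one slideStep maps St t to St (t+1)
-- (for t ≤ m) and fixes St (m+1).

module States (m : ℕ) (a b : ℕ → ℕ)
  (a-pos : ∀ j → j ≤ m → 1 ≤ a j) (b-pos : ∀ j → j ≤ m → 1 ≤ b j)
  (D E : ℕ) (br : Breaks m a b D E) where

  open Breaks br

  n : ℕ
  n = suc m

  StT : ℕ → ℕ → ℕ
  StT t j = if D <ᵇ t then (if j <ᵇ D then a (suc j) else (if j ≡ᵇ D then b D else a j))
            else (if j <ᵇ t then a (suc j) else (if j ≡ᵇ t then 0 else a j))

  StB : ℕ → ℕ → ℕ
  StB t j = if E <ᵇ t then (if j <ᵇ E then b j else (if suc j <ᵇ t then b (suc j) else (if suc j ≡ᵇ t then 0 else b j)))
            else b j

  St : ℕ → Filling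
  St t zero = StT t
  St t (suc zero) = StB t

  top-shifted : ∀ {t j} → t ≤ D → j < t → StT t j ≡ a (suc j)
  top-shifted {t} {j} t≤D j<t rewrite ≥⇒<ᵇ-false {D} {t} t≤D | <⇒<ᵇ-true j<t = refl

  top-hole : ∀ {t} → t ≤ D → StT t t ≡ 0
  top-hole {t} t≤D rewrite ≥⇒<ᵇ-false {D} {t} t≤D | ≥⇒<ᵇ-false {t} {t} ≤-refl | ≡ᵇ-refl t = refl

  top-unmoved : ∀ {t j} → t ≤ D → t < j → StT t j ≡ a j
  top-unmoved {t} {j} t≤D t<j
    rewrite ≥⇒<ᵇ-false {D} {t} t≤D | ≥⇒<ᵇ-false {j} {t} (<⇒≤ t<j) | ≢⇒≡ᵇ-false j t (λ e → <⇒≢ t<j (sym e)) = refl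

  top-shifted⁺ : ∀ {t j} → D < t → j < D → StT t j ≡ a (suc j)
  top-shifted⁺ {t} {j} D<t j<D rewrite <⇒<ᵇ-true D<t | <⇒<ᵇ-true j<D = refl

  top-dropped : ∀ {t} → D < t → StT t D ≡ b D
  top-dropped {t} D<t rewrite <⇒<ᵇ-true D<t | ≥⇒<ᵇ-false {D} {D} ≤-refl | ≡ᵇ-refl D = refl

  top-unmoved⁺ : ∀ {t j} → D < t → D < j → StT t j ≡ a j
  top-unmoved⁺ {t} {j} D<t D<j
    rewrite <⇒<ᵇ-true D<t | ≥⇒<ᵇ-false {j} {D} (<⇒≤ D<j) | ≢⇒≡ᵇ-false j D (λ e → <⇒≢ D<j (sym e)) = refl

  top-settled : ∀ {t t' j} → D < t → D < t' → StT t j ≡ StT t' j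
  top-settled D<t D<t' rewrite <⇒<ᵇ-true D<t | <⇒<ᵇ-true D<t' = refl

  bottom-unsplit : ∀ {t j} → t ≤ E → StB t j ≡ b j
  bottom-unsplit {t} t≤E rewrite ≥⇒<ᵇ-false {E} {t} t≤E = refl

  bottom-left : ∀ {t j} → E < t → j < E → StB t j ≡ b j
  bottom-left E<t j<E rewrite <⇒<ᵇ-true E<t | <⇒<ᵇ-true j<E = refl

  bottom-shifted : ∀ {t j} → E < t → E ≤ j → suc j < t → StB t j ≡ b (suc j)
  bottom-shifted {t} {j} E<t E≤j j<t rewrite <⇒<ᵇ-true E<t | ≥⇒<ᵇ-false {j} {E} E≤j | <⇒<ᵇ-true j<t = refl

  bottom-hole : ∀ {t j} → E < t → suc j ≡ t → StB t j ≡ 0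
  bottom-hole {t} {j} E<t refl
    rewrite <⇒<ᵇ-true E<t | ≥⇒<ᵇ-false {j} {E} (≤-pred E<t) | ≥⇒<ᵇ-false {suc j} {suc j} ≤-refl | ≡ᵇ-refl j = refl

  bottom-unmoved : ∀ {t j} → E < t → t ≤ j → StB t j ≡ b j
  bottom-unmoved {t} {j} E<t t≤j
    rewrite <⇒<ᵇ-true E<t | ≥⇒<ᵇ-false {j} {E} (≤-trans (<⇒≤ E<t) t≤j) | ≥⇒<ᵇ-false {suc j} {t} (≤-trans t≤j (n≤1+n j))
    | ≢⇒≡ᵇ-false (suc j) t (λ e → 1+n≰n (subst (_≤ j) (sym e) t≤j)) = refl

  bottom-diagonal : ∀ t → StB t t ≡ b t
  bottom-diagonal t with ≤-<-connex t E
  ... | inj₁ t≤E = bottom-unsplit t≤E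
  ... | inj₂ E<t = bottom-unmoved E<t ≤-refl

  a≢0 : ∀ {j} → j ≤ m → a j ≢ 0
  a≢0 j≤m = nonzero (a-pos _ j≤m)

  b≢0 : ∀ {j} → j ≤ m → b j ≢ 0
  b≢0 j≤m = nonzero (b-pos _ j≤m)

  top-zero : ∀ t j → j ≤ m → StT t j ≡ 0 → t ≤ D × j ≡ t
  top-zero t j j≤m z with ≤-<-connex t D
  top-zero t j j≤m z | inj₁ t≤D with <-cmp j t
  ... | tri< j<t _ _ = ⊥-elim (a≢0 (≤-trans j<t (≤-trans t≤D D≤m)) (trans (sym (top-shifted t≤D j<t)) z))
  ... | tri≈ _ e _ = t≤D , e
  ... | tri> _ _ t<j = ⊥-elim (a≢0 j≤m (trans (sym (top-unmoved t≤D t<j)) z))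
  top-zero t j j≤m z | inj₂ D<t with <-cmp j D
  ... | tri< j<D _ _ = ⊥-elim (a≢0 (≤-trans j<D D≤m) (trans (sym (top-shifted⁺ D<t j<D)) z))
  ... | tri≈ _ refl _ = ⊥-elim (b≢0 D≤m (trans (sym (top-dropped D<t)) z))
  ... | tri> _ _ D<j = ⊥-elim (a≢0 j≤m (trans (sym (top-unmoved⁺ D<t D<j)) z))

  bottom-zero : ∀ t j → t ≤ suc m → j ≤ m → StB t j ≡ 0 → E < t × suc j ≡ t
  bottom-zero t j t≤n j≤m z with ≤-<-connex t E
  ... | inj₁ t≤E = ⊥-elim (b≢0 j≤m (trans (sym (bottom-unsplit t≤E)) z))
  ... | inj₂ E<t with ≤-<-connex E j
  ... | inj₂ j<E = ⊥-elim (b≢0 j≤m (trans (sym (bottom-left E<t j<E)) z))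
  ... | inj₁ E≤j with <-cmp (suc j) t
  ... | tri< j<t _ _ = ⊥-elim (b≢0 (≤-pred (≤-trans j<t t≤n)) (trans (sym (bottom-shifted E<t E≤j j<t)) z))
  ... | tri≈ _ e _ = E<t , e
  ... | tri> _ _ t<j = ⊥-elim (b≢0 j≤m (trans (sym (bottom-unmoved E<t (≤-pred t<j))) z))

  keep-top : ∀ t j → StT t j ≢ 0 → (∀ j' → j ≡ suc j' → StT t j' ≢ 0) → slideStep n (St t) zero j ≡ StT t j
  keep-top t j labelled left-labelled =
    slide-keep n (St t) zero j labelled (all-nw-top j λ j' e → inj₁ (left-labelled j' e))

  keep-top-away : ∀ t j → j ≤ m → j ≢ t → j ≢ suc t → slideStep n (St t) zero j ≡ StT t j
  keep-top-away t j j≤m j≢t j≢t+1 = keep-top t j (λ z → j≢t (proj₂ (top-zero t j j≤m z)))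
    λ { j' refl z → j≢t+1 (cong suc (proj₂ (top-zero t j' (≤-trans (n≤1+n j') j≤m) z))) }

  -- Once the hole has dropped (t > D) the top row has no hole and is fixed.
  keep-top-settled : ∀ t j → D < t → j ≤ m → slideStep n (St t) zero j ≡ StT t j
  keep-top-settled t j D<t j≤m = keep-top t j (λ z → <⇒≱ D<t (proj₁ (top-zero t j j≤m z)))
    λ { j' refl z → <⇒≱ D<t (proj₁ (top-zero t j' (≤-trans (n≤1+n j') j≤m) z)) }

  keep-bottom : ∀ t j → StB t j ≢ 0 → NotTaking n (St t) (StB t j) (zero , j) → (∀ j' → j ≡ suc j' → StB t j' ≢ 0) →
    slideStep n (St t) (suc zero) j ≡ StB t j
  keep-bottom t j labelled above left-labelled =
    slide-keep n (St t) (suc zero) j labelled (all-nw-bottom j above λ j' e → inj₁ (left-labelled j' e))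

  keep-bottom-away : ∀ t j → t ≤ suc m → j ≤ m → j ≢ t → suc j ≢ t → slideStep n (St t) (suc zero) j ≡ StB t j
  keep-bottom-away t j t≤n j≤m j≢t j+1≢t = keep-bottom t j (λ z → j+1≢t (proj₂ (bottom-zero t j t≤n j≤m z)))
    (inj₁ λ z → j≢t (proj₂ (top-zero t j j≤m z)))
    λ { j' refl z → j≢t (proj₂ (bottom-zero t j' t≤n (≤-trans (n≤1+n j') j≤m) z)) }

  hole-takes< : ∀ t → t < D → minSEℕ n (St t) zero t ≡ just (a (suc t))
  hole-takes< t t<D = trans (minSE-top n (St t) t (a (suc t)) (b t) (s≤s (<-≤-trans t<D D≤m))
      (top-unmoved (<⇒≤ t<D) (n<1+n t)) (bottom-diagonal t) (a≢0 (<-≤-trans t<D D≤m)) (b≢0 (≤-trans (<⇒≤ t<D) D≤m)))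
    (cong just (min-left (D-before t t<D)))

  hole-takes-D : minSEℕ n (St D) zero D ≡ just (b D)
  hole-takes-D with m≤n⇒m<n∨m≡n D≤m
  ... | inj₂ refl = minSE-top-last n (St D) D (b D) ≤-refl (bottom-diagonal D) (b≢0 D≤m)
  ... | inj₁ D<m = trans (minSE-top n (St D) D (a (suc D)) (b D) (s≤s D<m) (top-unmoved ≤-refl (n<1+n D))
      (bottom-diagonal D) (a≢0 D<m) (b≢0 D≤m)) (cong just (min-right (<⇒≤ (D-at D<m))))

  top-left-of-hole : ∀ t j → t ≤ D → j < t → slideStep n (St t) zero j ≡ StT (suc t) j
  top-left-of-hole t j t≤D j<t = begin
    slideStep n (St t) zero j  ≡⟨ keep-top-away t j (≤-trans (<⇒≤ j<t) (≤-trans t≤D D≤m)) (<⇒≢ j<t) (<⇒≢ (<-trans j<t (n<1+n t))) ⟩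
    StT t j                    ≡⟨ top-shifted t≤D j<t ⟩
    a (suc j)                  ≡⟨ sym next ⟩
    StT (suc t) j              ∎
    where
    open ≡-Reasoning
    next : StT (suc t) j ≡ a (suc j)
    next with ≤-<-connex (suc t) D
    ... | inj₁ t<D = top-shifted t<D (<-trans j<t (n<1+n t))
    ... | inj₂ D≤t = top-shifted⁺ D≤t (<-≤-trans j<t t≤D)

  top-hole-fills : ∀ t → t ≤ D → slideStep n (St t) zero t ≡ StT (suc t) t
  top-hole-fills t t≤D rewrite slide-fill n (St t) zero t (top-hole t≤D) with m≤n⇒m<n∨m≡n t≤D
  ... | inj₁ t<D rewrite hole-takes< t t<D = sym (top-shifted t<D (n<1+n t))
  ... | inj₂ refl rewrite hole-takes-D = sym (top-dropped (n<1+n D))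

  -- The right neighbour of the hole is taken, unless the hole dropped at D.
  top-right-of-hole : ∀ t → t ≤ D → suc t ≤ m → slideStep n (St t) zero (suc t) ≡ StT (suc t) (suc t)
  top-right-of-hole t t≤D t<m with m≤n⇒m<n∨m≡n t≤D
  ... | inj₁ t<D = trans (slide-kill n (St t) zero (suc t) (λ z → a≢0 t<m (trans (sym next) z))
      (here (top-hole t≤D , trans (hole-takes< t t<D) (cong just (sym next))))) (sym (top-hole t<D))
    where
    next : StT t (suc t) ≡ a (suc t)
    next = top-unmoved t≤D (n<1+n t)
  ... | inj₂ refl = trans (slide-keep n (St D) zero (suc D) (λ z → a≢0 t<m (trans (sym next) z))
      (inj₂ (λ w e → subst (_≢ StT D (suc D)) (just-injective (trans (sym hole-takes-D) e)) bD≢next) ∷ []))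
      (trans next (sym (top-unmoved⁺ (n<1+n D) (n<1+n D))))
    where
    next : StT D (suc D) ≡ a (suc D)
    next = top-unmoved ≤-refl (n<1+n D)
    bD≢next : b D ≢ StT D (suc D)
    bD≢next e = <⇒≢ (D-at t<m) (trans e next)

  top-far-right : ∀ t j → t ≤ D → suc t < j → j ≤ m → slideStep n (St t) zero j ≡ StT (suc t) j
  top-far-right t j t≤D t+1<j j≤m = begin
    slideStep n (St t) zero j  ≡⟨ keep-top-away t j j≤m (λ e → <⇒≢ t<j (sym e)) (λ e → <⇒≢ t+1<j (sym e)) ⟩
    StT t j                    ≡⟨ top-unmoved t≤D t<j ⟩
    a j                        ≡⟨ sym next ⟩
    StT (suc t) j              ∎
    where
    open ≡-Reasoning
    t<j : t < j
    t<j = <-trans (n<1+n t) t+1<j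
    next : StT (suc t) j ≡ a j
    next with ≤-<-connex (suc t) D
    ... | inj₁ t<D = top-unmoved t<D t+1<j
    ... | inj₂ D≤t = top-unmoved⁺ D≤t (<-≤-trans D≤t (<⇒≤ t+1<j))

  slide-top : ∀ t j → t ≤ m → j ≤ m → slideStep n (St t) zero j ≡ StT (suc t) j
  slide-top t j t≤m j≤m with ≤-<-connex t D
  ... | inj₂ D<t = trans (keep-top-settled t j D<t j≤m) (top-settled D<t (<-trans D<t (n<1+n t)))
  ... | inj₁ t≤D with <-cmp j t
  ...   | tri< j<t _ _ = top-left-of-hole t j t≤D j<t
  ...   | tri≈ _ refl _ = top-hole-fills t t≤D
  ...   | tri> _ _ t<j with m≤n⇒m<n∨m≡n t<j
  ...     | inj₁ t+1<j = top-far-right t j t≤D t+1<j j≤m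
  ...     | inj₂ refl = top-right-of-hole t t≤D j≤m

  -- The bottom row before the split (t ≤ E): only the box below the top
  -- hole can change, and it is taken exactly when t = E.

  bottom-unsplit-next : ∀ t j → t ≤ E → j ≢ t → StB (suc t) j ≡ b j
  bottom-unsplit-next t j t≤E j≢t with ≤-<-connex (suc t) E
  ... | inj₁ t<E = bottom-unsplit t<E
  ... | inj₂ E<t+1 with <-cmp j E
  ...   | tri< j<E _ _ = bottom-left E<t+1 j<E
  ...   | tri≈ _ refl _ = ⊥-elim (j≢t (≤-antisym (≤-pred E<t+1) t≤E))
  ...   | tri> _ _ E<j = bottom-unmoved E<t+1 (≤-trans (s≤s t≤E) E<j)

  bottom-away-from-hole : ∀ t j → t ≤ E → j ≤ m → j ≢ t → slideStep n (St t) (suc zero) j ≡ StB (suc t) j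
  bottom-away-from-hole t j t≤E j≤m j≢t =
    trans (keep-bottom t j (λ z → <⇒≱ (proj₁ (bottom-zero t j (≤-trans t≤m (n≤1+n m)) j≤m z)) t≤E)
             (inj₁ λ z → j≢t (proj₂ (top-zero t j j≤m z)))
             λ { j' refl z → <⇒≱ (proj₁ (bottom-zero t j' (≤-trans t≤m (n≤1+n m)) (≤-trans (n≤1+n j') j≤m) z)) t≤E })
          (trans (bottom-unsplit t≤E) (sym (bottom-unsplit-next t j t≤E j≢t)))
    where
    t≤m : t ≤ m
    t≤m = ≤-trans t≤E E≤m

  -- Before E the top hole takes a_{t+1} < b_t, so b_t stays.
  bottom-below-hole : ∀ t → t < E → slideStep n (St t) (suc zero) t ≡ StB (suc t) t
  bottom-below-hole t t<E =
    trans (keep-bottom t t (λ z → <⇒≱ (proj₁ (bottom-zero t t (≤-trans t≤m (n≤1+n m)) t≤m z)) (<⇒≤ t<E))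
             (inj₂ (λ w e → subst (_≢ StB t t) (just-injective (trans (sym (hole-takes< t (<-≤-trans t<E E≤D))) e))
                      (λ e' → <⇒≢ (E-before t t<E) (trans e' (bottom-diagonal t)))))
             λ { j' refl z → <⇒≱ (proj₁ (bottom-zero t j' (≤-trans t≤m (n≤1+n m)) (≤-trans (n≤1+n j') t≤m) z)) (<⇒≤ t<E) })
          (trans (bottom-unsplit (<⇒≤ t<E)) (sym (bottom-unsplit t<E)))
    where
    t≤m : t ≤ m
    t≤m = ≤-trans (<⇒≤ t<E) E≤m

  -- At column E the top hole takes b_E (= a_{E+1} if E < D): the hole splits.
  bottom-splits : slideStep n (St E) (suc zero) E ≡ StB (suc E) E
  bottom-splits = trans (slide-kill n (St E) (suc zero) E (λ z → b≢0 E≤m (trans (sym (bottom-diagonal E)) z))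
                     (any-nw-above E (top-hole E≤D , trans takes-bE (cong just (sym (bottom-diagonal E))))))
                   (sym (bottom-hole (n<1+n E) refl))
    where
    takes-bE : minSEℕ n (St E) zero E ≡ just (b E)
    takes-bE with m≤n⇒m<n∨m≡n E≤D
    ... | inj₁ E<D = trans (hole-takes< E E<D)
                       (cong just (≤-antisym (D-before E E<D) (E-at (<-≤-trans E<D D≤m))))
    ... | inj₂ refl = hole-takes-D

  slide-bottom-unsplit : ∀ t j → t ≤ E → j ≤ m → slideStep n (St t) (suc zero) j ≡ StB (suc t) j
  slide-bottom-unsplit t j t≤E j≤m with j ≟ t
  ... | no j≢t = bottom-away-from-hole t j t≤E j≤m j≢t
  ... | yes refl with m≤n⇒m<n∨m≡n t≤E
  ...   | inj₁ t<E = bottom-below-hole t t<E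
  ...   | inj₂ refl = bottom-splits

  -- After the split (t > E) the bottom hole sits at column t − 1 and slides right.

  bottom-right-of-hole : ∀ t j → E < t → t < j → j ≤ m → slideStep n (St t) (suc zero) j ≡ StB (suc t) j
  bottom-right-of-hole t j E<t t<j j≤m =
    trans (keep-bottom-away t j (≤-trans (<⇒≤ t<j) (≤-trans j≤m (n≤1+n m))) j≤m (λ e → <⇒≢ t<j (sym e))
              (λ e → <⇒≢ (<-trans t<j (n<1+n j)) (sym e)))
          (trans (bottom-unmoved E<t (<⇒≤ t<j)) (sym (bottom-unmoved (<-trans E<t (n<1+n t)) t<j)))

  bottom-taken : ∀ j → E < suc j → suc j ≤ m → slideStep n (St (suc j)) (suc zero) (suc j) ≡ StB (suc (suc j)) (suc j)
  bottom-taken j E<t t≤m =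
    trans (slide-kill n (St (suc j)) (suc zero) (suc j) labelled
             (here (bottom-hole E<t refl , minSE-bottom n (St (suc j)) j (StB (suc j) (suc j)) (s≤s t≤m) refl labelled)))
          (sym (bottom-hole (<-trans E<t (n<1+n (suc j))) refl))
    where
    labelled : StB (suc j) (suc j) ≢ 0
    labelled z = b≢0 t≤m (trans (sym (bottom-unmoved E<t ≤-refl)) z)

  bottom-hole-fills : ∀ t j → E < t → suc j ≡ t → t ≤ m → slideStep n (St t) (suc zero) j ≡ StB (suc t) j
  bottom-hole-fills t j E<t refl t≤m =
    trans (slide-fill n (St t) (suc zero) j (bottom-hole E<t refl))
          (trans (cong orZero (minSE-bottom n (St t) j (b t) (s≤s t≤m) (bottom-unmoved E<t ≤-refl) (b≢0 t≤m)))
                 (sym (bottom-shifted (<-trans E<t (n<1+n t)) (≤-pred E<t) (n<1+n t))))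

  bottom-left-of-hole : ∀ t j → E < t → suc j < t → t ≤ m → slideStep n (St t) (suc zero) j ≡ StB (suc t) j
  bottom-left-of-hole t j E<t j+1<t t≤m =
    trans (keep-bottom-away t j (≤-trans t≤m (n≤1+n m)) (≤-trans (<⇒≤ j<t) t≤m) (<⇒≢ j<t) (<⇒≢ j+1<t)) same
    where
    j<t : j < t
    j<t = <-trans (n<1+n j) j+1<t
    E<t+1 : E < suc t
    E<t+1 = <-trans E<t (n<1+n t)
    same : StB t j ≡ StB (suc t) j
    same with ≤-<-connex E j
    ... | inj₁ E≤j = trans (bottom-shifted E<t E≤j j+1<t) (sym (bottom-shifted E<t+1 E≤j (<-trans j+1<t (n<1+n t))))
    ... | inj₂ j<E = trans (bottom-left E<t j<E) (sym (bottom-left E<t+1 j<E))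

  slide-bottom-split : ∀ t j → E < t → t ≤ m → j ≤ m → slideStep n (St t) (suc zero) j ≡ StB (suc t) j
  slide-bottom-split t j E<t t≤m j≤m with <-cmp j t
  ... | tri> _ _ t<j = bottom-right-of-hole t j E<t t<j j≤m
  ... | tri< j<t _ _ with m≤n⇒m<n∨m≡n j<t
  ...   | inj₁ j+1<t = bottom-left-of-hole t j E<t j+1<t t≤m
  ...   | inj₂ j+1≡t = bottom-hole-fills t j E<t j+1≡t t≤m
  slide-bottom-split (suc j') j E<t t≤m j≤m | tri≈ _ refl _ = bottom-taken j' E<t t≤m

  slide-bottom : ∀ t j → t ≤ m → j ≤ m → slideStep n (St t) (suc zero) j ≡ StB (suc t) j
  slide-bottom t j t≤m j≤m with ≤-<-connex t E
  ... | inj₁ t≤E = slide-bottom-unsplit t j t≤E j≤m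
  ... | inj₂ E<t = slide-bottom-split t j E<t t≤m j≤m

  -- After m + 1 steps no empty box has an SE-neighbour: St n is fixed.

  slide-top-final : ∀ j → j ≤ m → slideStep n (St n) zero j ≡ StT n j
  slide-top-final j j≤m = keep-top-settled n j (s≤s D≤m) j≤m

  slide-bottom-final : ∀ j → j ≤ m → slideStep n (St n) (suc zero) j ≡ StB n j
  slide-bottom-final j j≤m with m≤n⇒m<n∨m≡n j≤m
  ... | inj₁ j<m = keep-bottom-away n j ≤-refl j≤m (λ e → <⇒≢ (s≤s j≤m) e) (λ e → <⇒≢ (s≤s j<m) e)
  ... | inj₂ refl = trans (slide-fill n (St n) (suc zero) j (bottom-hole (s≤s E≤m) refl))
                     (trans (cong orZero (minSE-bottom-last n (St n) j ≤-refl)) (sym (bottom-hole (s≤s E≤m) refl)))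

maxEntry-increasing : ∀ {n M} (T : Tab n) → IsIncreasingWithMax n M T → 1 ≤ M → maxEntry T ≡ M
maxEntry-increasing {n} {M} T inc 1≤M = ≤-antisym (foldr⊔-least columnMaxima bounded-by-M) M-attained
  where
  open IsIncreasingWithMax inc
  columnMax : Fin n → ℕ
  columnMax c = T zero c ⊔ T (suc zero) c
  columnMaxima : List ℕ
  columnMaxima = map columnMax (allFin n)

  bounded-by-M : ∀ {x} → x ∈ columnMaxima → x ≤ M
  bounded-by-M p with ∈-map⁻ columnMax p
  ... | c , _ , refl = ⊔-lub (bounded zero c) (bounded (suc zero) c)

  below-maxEntry : ∀ c → columnMax c ≤ maxEntry T
  below-maxEntry c = foldr⊔-upper columnMaxima (∈-map⁺ columnMax (∈-allFin c))

  M-attained : M ≤ maxEntry T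
  M-attained with surjective M 1≤M ≤-refl
  ... | (zero , c) , e = subst (_≤ maxEntry T) e (≤-trans (m≤m⊔n (T zero c) _) (below-maxEntry c))
  ... | (suc zero , c) , e = subst (_≤ maxEntry T) e (≤-trans (m≤n⊔m (T zero c) _) (below-maxEntry c))

-- Reading the rows of a 2 × (m+1) filling as maps ℕ → ℕ (columns beyond m
-- are clamped to m, which is irrelevant since only columns ≤ m are used).

clampFin : (m : ℕ) → ℕ → Fin (suc m)
clampFin zero j = zero
clampFin (suc m) zero = zero
clampFin (suc m) (suc j) = suc (clampFin m j)

clampFin-toℕ : ∀ m (x : Fin (suc m)) → clampFin m (toℕ x) ≡ x
clampFin-toℕ zero zero = refl
clampFin-toℕ (suc m) zero = refl
clampFin-toℕ (suc m) (suc x) = cong suc (clampFin-toℕ m x)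

toℕ-clampFin : ∀ m j → j ≤ m → toℕ (clampFin m j) ≡ j
toℕ-clampFin zero zero p = refl
toℕ-clampFin (suc m) zero p = refl
toℕ-clampFin (suc m) (suc j) (s≤s p) = cong suc (toℕ-clampFin m j p)

clampFin-zero : ∀ m → clampFin m 0 ≡ zero
clampFin-zero zero = refl
clampFin-zero (suc m) = refl

topRow bottomRow : ∀ {m} → Tab (suc m) → ℕ → ℕ
topRow {m} T j = T zero (clampFin m j)
bottomRow {m} T j = T (suc zero) (clampFin m j)

module Rows (m M : ℕ) (T : Tab (suc m)) (inc : IsIncreasingWithMax (suc m) M T) where

  open IsIncreasingWithMax inc

  a b : ℕ → ℕ
  a = topRow T
  b = bottomRow T

  a-pos : ∀ j → j ≤ m → 1 ≤ a j
  a-pos j _ = positive zero (clampFin m j)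

  b-pos : ∀ j → j ≤ m → 1 ≤ b j
  b-pos j _ = positive (suc zero) (clampFin m j)

  a<b : ∀ j → a j < b j
  a<b j = colStrict (clampFin m j)

  b≤M : ∀ j → b j ≤ M
  b≤M j = bounded (suc zero) (clampFin m j)

  a≤M : ∀ j → a j ≤ M
  a≤M j = bounded zero (clampFin m j)

  private
    columns-ordered : ∀ {j j'} → j < j' → j' ≤ m → toℕ (clampFin m j) < toℕ (clampFin m j')
    columns-ordered {j} {j'} j<j' j'≤m =
      subst₂ _<_ (sym (toℕ-clampFin m j (≤-trans (<⇒≤ j<j') j'≤m))) (sym (toℕ-clampFin m j' j'≤m)) j<j'

  a-inc : ∀ j j' → j < j' → j' ≤ m → a j < a j'
  a-inc j j' j<j' j'≤m = rowStrict zero (clampFin m j) (clampFin m j') (columns-ordered j<j' j'≤m)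

  b-inc : ∀ j j' → j < j' → j' ≤ m → b j < b j'
  b-inc j j' j<j' j'≤m = rowStrict (suc zero) (clampFin m j) (clampFin m j') (columns-ordered j<j' j'≤m)

  T-top : ∀ x → T zero x ≡ a (toℕ x)
  T-top x = cong (T zero) (sym (clampFin-toℕ m x))

  T-bottom : ∀ x → T (suc zero) x ≡ b (toℕ x)
  T-bottom x = cong (T (suc zero)) (sym (clampFin-toℕ m x))

  corner≡1 : T zero zero ≡ 1
  corner≡1 with surjective 1 ≤-refl (≤-trans (positive zero zero) (bounded zero zero))
  ... | (zero , zero) , e = e
  ... | (zero , suc c) , e = ⊥-elim (<⇒≱ (rowStrict zero zero (suc c) (s≤s z≤n)) (subst (_≤ T zero zero) (sym e) (positive zero zero)))
  ... | (suc zero , c) , e = ⊥-elim (<⇒≱ (colStrict c) (subst (_≤ T zero c) (sym e) (positive zero c)))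

  a₀≡1 : a 0 ≡ 1
  a₀≡1 = trans (cong (T zero) (clampFin-zero m)) corner≡1

-- K-promotion of T in closed form: after deleting 1 the filling is St 0,
-- each of the first m + 1 sliding steps advances the state, and St (m+1)
-- is fixed, so 𝒫(T) is read off from St (m+1).

module Promotion (m M : ℕ) (T : Tab (suc m)) (inc : IsIncreasingWithMax (suc m) M T)
  (D E : ℕ) (br : Breaks m (topRow T) (bottomRow T) D E) where

  open Rows m M T inc
  open States m a b a-pos b-pos D E br public

  Represents : Tab (suc m) → ℕ → Set
  Represents S t = ∀ r x → S r x ≡ St t r (toℕ x)

  private
    column-bound : ∀ (x : Fin (suc m)) → toℕ x ≤ m
    column-bound x = ≤-pred (toℕ<n x)

  step-represents : ∀ S t → t ≤ m → Represents S t → Represents (kStep S) (suc t)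
  step-represents S t t≤m S≗St zero x =
    trans (kStep-as-slideStep S (St t) S≗St zero x) (slide-top t (toℕ x) t≤m (column-bound x))
  step-represents S t t≤m S≗St (suc zero) x =
    trans (kStep-as-slideStep S (St t) S≗St (suc zero) x) (slide-bottom t (toℕ x) t≤m (column-bound x))

  final-represents : ∀ S → Represents S n → Represents (kStep S) n
  final-represents S S≗St zero x =
    trans (kStep-as-slideStep S (St n) S≗St zero x) (slide-top-final (toℕ x) (column-bound x))
  final-represents S S≗St (suc zero) x =
    trans (kStep-as-slideStep S (St n) S≗St (suc zero) x) (slide-bottom-final (toℕ x) (column-bound x))

  iterate-represents : ∀ k t S → t ≤ n → n ≤ t + k → Represents S t → Represents (iterate k kStep S) n
  iterate-represents zero t S t≤n n≤t S≗St rewrite ≤-antisym t≤n (subst (n ≤_) (+-identityʳ t) n≤t) = S≗St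
  iterate-represents (suc k) t S t≤n n≤t+k S≗St with m≤n⇒m<n∨m≡n t≤n
  ... | inj₁ t<n = iterate-represents k (suc t) (kStep S) t<n (subst (n ≤_) (+-suc t k) n≤t+k) (step-represents S t (≤-pred t<n) S≗St)
  ... | inj₂ refl = iterate-represents k n (kStep S) ≤-refl (m≤m+n n k) (final-represents S S≗St)

  deleted : Tab (suc m)
  deleted r c = if T r c ≡ᵇ 1 then 0 else T r c

  deleted-represents : Represents deleted 0
  deleted-represents zero zero rewrite corner≡1 = refl
  deleted-represents zero (suc x) with T zero (suc x) ≡ᵇ 1 in e
  ... | true = ⊥-elim (<⇒≢ (subst (_< T zero (suc x)) corner≡1 (rowStrict zero zero (suc x) (s≤s z≤n))) (sym (≡ᵇ-true⇒≡ _ _ e)))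
    where open IsIncreasingWithMax inc
  ... | false = T-top (suc x)
  deleted-represents (suc zero) x with T (suc zero) x ≡ᵇ 1 in e
  ... | true = ⊥-elim (<⇒≢ (≤-<-trans (positive zero x) (colStrict x)) (sym (≡ᵇ-true⇒≡ _ _ e)))
    where open IsIncreasingWithMax inc
  ... | false = T-bottom x

  relabel : ℕ → ℕ
  relabel v = if isEmpty v then maxEntry T else v ∸ 1

  kPro-closed-form : ∀ r x → kPro T r x ≡ relabel (St n r (toℕ x))
  kPro-closed-form r x rewrite iterate-represents (suc n) 0 deleted z≤n (n≤1+n n) deleted-represents r x = refl

-- T has rows a (top, a₀ = 1) and b; rP is the
-- top row of 𝒫(T) shifted up by one, which consists of a₁ … a_m and b_D.
-- The bottom row of 𝒫(T), shifted, is b₀ … b_{E−1}, b_{E+1} … b_m, N + 1.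

module Pairing (m N : ℕ) (a b : ℕ → ℕ)
  (a-inc : ∀ j j' → j < j' → j' ≤ m → a j < a j')
  (b-inc : ∀ j j' → j < j' → j' ≤ m → b j < b j')
  (a<b : ∀ j → a j < b j)
  (a₀≡1 : a 0 ≡ 1)
  (b≤N : ∀ j → j ≤ m → b j ≤ N)
  (D E : ℕ) (br : Breaks m a b D E)
  (rP : List ℕ)
  (rP⁻ : ∀ {x} → x ∈ rP → (Σ ℕ λ j → 1 ≤ j × j ≤ m × a j ≡ x) ⊎ x ≡ b D)
  (rP⁺ : ∀ j → 1 ≤ j → j ≤ m → a j ∈ rP)
  (bD∈rP : b D ∈ rP) where

  open Breaks br

  rT : List ℕ
  rT = seg a 0 (suc m)

  RT : ℕ → List ℕ
  RT c = seg b c (suc m ∸ c)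

  RT-cons : ∀ c → c ≤ m → RT c ≡ b c ∷ RT (suc c)
  RT-cons c c≤m rewrite +-∸-assoc 1 c≤m = refl

  -- the bottom row of 𝒫(T) (shifted) after column E, and after column D
  restE restD : List ℕ
  restE = seg b (suc E) (m ∸ E) ++ suc N ∷ []
  restD = seg b (suc D) (m ∸ D) ++ suc N ∷ []

  rT⁻ : ∀ {x} → x ∈ rT → Σ ℕ λ j → j ≤ m × a j ≡ x
  rT⁻ p with seg-∈⁻ a 0 (suc m) p
  ... | j , _ , j<n , e = j , ≤-pred j<n , e

  rT⁺ : ∀ j → j ≤ m → a j ∈ rT
  rT⁺ j j≤m = seg-∈⁺ a 0 (suc m) j z≤n (s≤s j≤m)

  a-mono : ∀ {j j'} → j ≤ j' → j' ≤ m → a j ≤ a j'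
  a-mono {j} {j'} j≤j' j'≤m with m≤n⇒m<n∨m≡n j≤j'
  ... | inj₁ j<j' = <⇒≤ (a-inc j j' j<j' j'≤m)
  ... | inj₂ refl = ≤-refl

  b-mono : ∀ {j j'} → j ≤ j' → j' ≤ m → b j ≤ b j'
  b-mono {j} {j'} j≤j' j'≤m with m≤n⇒m<n∨m≡n j≤j'
  ... | inj₁ j<j' = <⇒≤ (b-inc j j' j<j' j'≤m)
  ... | inj₂ refl = ≤-refl

  a≢1 : ∀ {j} → 1 ≤ j → j ≤ m → a j ≢ 1
  a≢1 {j} 1≤j j≤m e = <⇒≢ (subst (_< a j) a₀≡1 (a-inc 0 j 1≤j j≤m)) (sym e)

  1∈rT : 1 ∈ rT
  1∈rT = subst (_∈ rT) a₀≡1 (rT⁺ 0 z≤n)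

  1<b : ∀ {c} → c ≤ m → 1 < b c
  1<b {c} c≤m = subst (_< b c) a₀≡1 (<-≤-trans (a<b 0) (b-mono z≤n c≤m))

  rT-above-1 : ∀ {x} → x ∈ rT → x ≢ 1 → Σ ℕ λ j → 1 ≤ j × j ≤ m × a j ≡ x
  rT-above-1 p x≢1 with rT⁻ p
  ... | zero , _ , e = ⊥-elim (x≢1 (trans (sym e) a₀≡1))
  ... | suc j , j≤m , e = suc j , s≤s z≤n , j≤m , e

  rT-in-rP : ∀ {x} → x ∈ rT → x ≢ 1 → x ∈ rP
  rT-in-rP p x≢1 with rT-above-1 p x≢1
  ... | j , 1≤j , j≤m , refl = rP⁺ j 1≤j j≤m

  -- b_D is not in T's top row: a_j < b_D for j ≤ D and b_D < a_j for j > D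
  bD∉rT : ∀ {x} → x ∈ rT → x ≢ b D
  bD∉rT p e with rT⁻ p
  ... | j , j≤m , refl with ≤-<-connex j D
  ... | inj₁ j≤D = <⇒≢ (≤-<-trans (a-mono j≤D D≤m) (a<b D)) e
  ... | inj₂ D<j = <⇒≢ (<-≤-trans (D-at (<-≤-trans D<j j≤m)) (a-mono D<j j≤m)) (sym e)

  below-column : ∀ c {j} → j ≤ m → a j < b c → (c < m → b c ≤ a (suc c)) → j ≤ c
  below-column c {j} j≤m aj<bc bc≤ with ≤-<-connex j c
  ... | inj₁ j≤c = j≤c
  ... | inj₂ c<j = ⊥-elim (<⇒≱ aj<bc (≤-trans (bc≤ (<-≤-trans c<j j≤m)) (a-mono c<j j≤m)))

  a-distinct : ∀ i k → i + k ≤ suc m → Distinct (seg a i k)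
  a-distinct i k i+k≤n = seg-distinct a i k (λ j j' _ j<j' j'<end → a-inc j j' j<j' (≤-pred (≤-trans j'<end i+k≤n)))

  record UsedBefore (c : ℕ) (u : List ℕ) : Set where
    field
      length≡  : length u ≡ c
      distinct : Distinct u
      ⊆rT      : ∀ {x} → x ∈ u → x ∈ rT
      below    : ∀ {x} → x ∈ u → c ≤ m → x < b c
  open UsedBefore

  nothing-used : UsedBefore 0 []
  nothing-used = record { length≡ = refl ; distinct = tt ; ⊆rT = λ () ; below = λ () }

  use : ∀ {c u s} → UsedBefore c u → s ∈ rT → s ∉ u → s < b c → c ≤ m → UsedBefore (suc c) (s ∷ u)
  use used s∈rT s∉u s<bc c≤m = record
    { length≡ = cong suc (length≡ used)
    ; distinct = s∉u , distinct used
    ; ⊆rT = λ { (here refl) → s∈rT ; (there p) → ⊆rT used p }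
    ; below = λ { (here refl) c<m → <-trans s<bc (b-inc _ _ (n<1+n _) c<m)
                ; (there p) c<m → <-trans (below used p c≤m) (b-inc _ _ (n<1+n _) c<m) } }

  unused-a : ∀ i k u → i + k ≤ suc m → length u < k → Σ ℕ λ j → i ≤ j × j < i + k × a j ∉ u
  unused-a i k u i+k≤n short
    with missing-element (seg a i k) u (a-distinct i k i+k≤n) (subst (length u <_) (sym (seg-length a i k)) short)
  ... | x , x∈seg , x∉u with seg-∈⁻ a i k x∈seg
  ... | j , i≤j , j<end , refl = j , i≤j , j<end , x∉u

  -- From column E on, T has used 1 while P has not: the used lists of T and
  -- P agree except that 1 is used by T only.
  record Shadow (uT uP : List ℕ) : Set where
    field
      1∈uT : 1 ∈ uT
      uP⊆uT : ∀ {x} → x ∈ uP → x ∈ uT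
      uT⊆uP : ∀ {x} → x ∈ uT → x ≢ 1 → x ∈ uP
  open Shadow

  shadow-use : ∀ {uT uP} s → Shadow uT uP → Shadow (s ∷ uT) (s ∷ uP)
  shadow-use s sh = record
    { 1∈uT = there (1∈uT sh)
    ; uP⊆uT = λ { (here refl) → here refl ; (there p) → there (uP⊆uT sh p) }
    ; uT⊆uP = λ { (here refl) _ → here refl ; (there p) x≢1 → there (uT⊆uP sh p x≢1) } }

  -- P makes T's choice s at the bottom entry b_c, provided s ≠ 1, the used
  -- lists agree away from 1, and b_D (which P has but T has not) does not
  -- beat s.
  same-choice : ∀ c uT uP s → chooseS rT uT (b c) ≡ just s → s ≢ 1 →
    (∀ {x} → x ∈ uP → x ∈ uT) → (∀ {x} → x ∈ uT → x ≢ 1 → x ∈ uP) → (b D < b c → b D ≤ s) →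
    chooseS rP uP (b c) ≡ just s
  same-choice c uT uP s eqT s≢1 uP⊆uT uT⊆uP bD≤s with chooseS-just rT uT (b c) s eqT
  ... | (s∈rT , s<bc , s∉uT) , s-max = chooseS-max rP uP (b c) s (rT-in-rP s∈rT s≢1 , s<bc , λ p → s∉uT (uP⊆uT p)) best
    where
    best : ∀ y → Available rP uP (b c) y → y ≤ s
    best y (y∈rP , y<bc , y∉uP) with rP⁻ y∈rP
    ... | inj₁ (j , 1≤j , j≤m , refl) = s-max y (rT⁺ j j≤m , y<bc , λ p → y∉uP (uT⊆uP p (a≢1 1≤j j≤m)))
    ... | inj₂ refl = bD≤s y<bc

  record Run (c : ℕ) (uT uP bsP : List ℕ) (c' : ℕ) (bsP' : List ℕ) (Inv : List ℕ → List ℕ → Set) : Set where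
    field
      common : List (ℕ × ℕ)
      usedT usedP : List ℕ
      reached : Inv usedT usedP
      runT : pairsGo rT uT (RT c) ≡ common ++ pairsGo rT usedT (RT c')
      runP : pairsGo rP uP bsP ≡ common ++ pairsGo rP usedP bsP'
  open Run

  run-stop : ∀ {c uT uP bsP Inv} → Inv uT uP → Run c uT uP bsP c bsP Inv
  run-stop inv = record { common = [] ; usedT = _ ; usedP = _ ; reached = inv ; runT = refl ; runP = refl }

  run-step : ∀ {c uT uP bsP c' bsP' Inv} s → c ≤ m → chooseS rT uT (b c) ≡ just s → chooseS rP uP (b c) ≡ just s →
    Run (suc c) (s ∷ uT) (s ∷ uP) bsP c' bsP' Inv → Run c uT uP (b c ∷ bsP) c' bsP' Inv
  run-step {c} {uT} {uP} {bsP} s c≤m eqT eqP r = record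
    { common = (b c , s) ∷ common r ; usedT = usedT r ; usedP = usedP r ; reached = reached r
    ; runT = trans (cong (pairsGo rT uT) (RT-cons c c≤m))
                   (trans (pairsGo-step rT uT (b c) (RT (suc c)) s eqT) (cong ((b c , s) ∷_) (runT r)))
    ; runP = trans (pairsGo-step rP uP (b c) bsP s eqP) (cong ((b c , s) ∷_) (runP r)) }

  run-then : ∀ {c uT uP bsP c' bsP' c'' bsP'' Inv Inv'} (r : Run c uT uP bsP c' bsP' Inv) →
    Run c' (usedT r) (usedP r) bsP' c'' bsP'' Inv' → Run c uT uP bsP c'' bsP'' Inv'
  run-then r r' = record
    { common = common r ++ common r' ; usedT = usedT r' ; usedP = usedP r' ; reached = reached r'
    ; runT = trans (runT r) (trans (cong (common r ++_) (runT r')) (sym (ListProps.++-assoc (common r) (common r') _)))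
    ; runP = trans (runP r) (trans (cong (common r ++_) (runP r')) (sym (ListProps.++-assoc (common r) (common r') _))) }

  -- Phase 1, columns c < E: T never uses 1, and P chooses exactly as T.

  Phase1 : ℕ → List ℕ → Set
  Phase1 c u = UsedBefore c u × 1 ∉ u

  phase1-choice : ∀ c u → c < E → Phase1 c u → Σ ℕ λ s → chooseS rT u (b c) ≡ just s × s ≢ 1 × Phase1 (suc c) (s ∷ u)
  phase1-choice c u c<E (used , 1∉u)
    with unused-a 1 (suc c) u (s≤s (<-≤-trans c<E E≤m)) (subst (_< suc c) (sym (length≡ used)) (n<1+n c))
  ... | j , 1≤j , j<c+2 , aj∉u = choose (chooseS-some rT u (b c) (a j) aj-available)
    where
    c<m : c < m
    c<m = <-≤-trans c<E E≤m
    j≤c+1 : j ≤ suc c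
    j≤c+1 = ≤-pred j<c+2
    -- a_j ≤ a_{c+1} < b_c
    aj-available : Available rT u (b c) (a j)
    aj-available = rT⁺ j (≤-trans j≤c+1 c<m) , ≤-<-trans (a-mono j≤c+1 c<m) (E-before c c<E) , aj∉u

    choose : (Σ ℕ λ s → chooseS rT u (b c) ≡ just s) → Σ ℕ λ s → chooseS rT u (b c) ≡ just s × s ≢ 1 × Phase1 (suc c) (s ∷ u)
    choose (s , eqT) with chooseS-just rT u (b c) s eqT
    ... | (s∈rT , s<bc , s∉u) , s-max =
      s , eqT , s≢1 , use used s∈rT s∉u s<bc (<⇒≤ c<m) , λ { (here 1≡s) → s≢1 (sym 1≡s) ; (there p) → 1∉u p }
      where
      -- s is at least the available a_j > a₀ = 1
      s≢1 : s ≢ 1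
      s≢1 s≡1 = <⇒≱ (subst (_< a j) a₀≡1 (a-inc 0 j 1≤j (≤-trans j≤c+1 c<m))) (subst (a j ≤_) s≡1 (s-max (a j) aj-available))

  phase1 : ∀ k c u → c + k ≡ E → Phase1 c u →
    Run c u u (seg b c k ++ restE) E restE (λ uT uP → Phase1 E uT × uP ≡ uT)
  phase1 zero c u e inv with ≡-of-+0 e
  ... | refl = run-stop (inv , refl)
  phase1 (suc k) c u e inv with phase1-choice c u (<-of-+suc e) inv
  ... | s , eqT , s≢1 , inv' = run-step s c≤m eqT eqP (phase1 k (suc c) (s ∷ u) (trans (sym (+-suc c k)) e) inv')
    where
    c≤D : c ≤ D
    c≤D = ≤-trans (<⇒≤ (<-of-+suc e)) E≤D
    c≤m : c ≤ m
    c≤m = ≤-trans c≤D D≤m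
    eqP : chooseS rP u (b c) ≡ just s
    eqP = same-choice c u u s eqT s≢1 (λ p → p) (λ p _ → p) (λ bD<bc → ⊥-elim (<⇒≱ bD<bc (b-mono c≤D D≤m)))

  -- At column E all of a₁ … a_E have been used, so T pairs b_E with 1.

  used-up-to-E : ∀ {u} → Phase1 E u → ∀ {y} → y ∈ rT → y < b E → y ≡ 1 ⊎ y ∈ u
  used-up-to-E {u} (used , 1∉u) {y} y∈rT y<bE with rT⁻ y∈rT
  ... | zero , _ , e = inj₁ (trans (sym e) a₀≡1)
  ... | suc j , j≤m , refl = inj₂ (exhausts (seg a 1 E) u (distinct used) u⊆seg
          (≤-reflexive (trans (seg-length a 1 E) (sym (length≡ used))))
          (seg-∈⁺ a 1 E (suc j) (s≤s z≤n) (s≤s (below-column E j≤m y<bE E-at))))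
    where
    u⊆seg : ∀ {x} → x ∈ u → x ∈ seg a 1 E
    u⊆seg x∈u with rT-above-1 (⊆rT used x∈u) (λ { refl → 1∉u x∈u })
    ... | j' , 1≤j' , j'≤m , refl = seg-∈⁺ a 1 E j' 1≤j' (s≤s (below-column E j'≤m (below used x∈u E≤m) E-at))

  T-takes-1 : ∀ {u} → Phase1 E u → chooseS rT u (b E) ≡ just 1
  T-takes-1 {u} inv = chooseS-max rT u (b E) 1 (1∈rT , 1<b E≤m , λ p → proj₂ inv p) best
    where
    best : ∀ y → Available rT u (b E) y → y ≤ 1
    best y (y∈rT , y<bE , y∉u) with used-up-to-E inv y∈rT y<bE
    ... | inj₁ refl = ≤-refl
    ... | inj₂ y∈u = ⊥-elim (y∉u y∈u)

  shadow-after-1 : ∀ u → Shadow (1 ∷ u) u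
  shadow-after-1 u = record
    { 1∈uT = here refl ; uP⊆uT = there ; uT⊆uP = λ { (here refl) x≢1 → ⊥-elim (x≢1 refl) ; (there p) _ → p } }

  -- In phase 3 (columns > D)
  -- every top entry up to b_D is used by T; in phase 2 (columns E < c ≤ D)
  -- there is a pending entry z: the least top entry not used by T.

  Phase3 : ℕ → List ℕ → List ℕ → Set
  Phase3 c uT uP = UsedBefore c uT × Shadow uT uP × (∀ {y} → y ∈ rT → y ≤ b D → y ∈ uT)

  record Pending (c : ℕ) (uT : List ℕ) (z : ℕ) : Set where
    field
      z∈rT : z ∈ rT
      z∉uT : z ∉ uT
      smaller-used : ∀ {y} → y ∈ rT → y < z → y ∈ uT
      z<bc : z < b c
  open Pending

  Phase2 : ℕ → List ℕ → List ℕ → ℕ → Set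
  Phase2 c uT uP z = UsedBefore c uT × Shadow uT uP × Pending c uT z

  choice-not-1 : ∀ {c uT s} → 1 ∈ uT → chooseS rT uT (b c) ≡ just s → s ≢ 1
  choice-not-1 {c} {uT} {s} 1∈uT eqT refl = proj₂ (proj₂ (proj₁ (chooseS-just rT uT (b c) s eqT))) 1∈uT

  -- Up to column D, b_D is no candidate, so P follows T.
  same-choice-≤D : ∀ c uT uP s → c ≤ D → Shadow uT uP → chooseS rT uT (b c) ≡ just s → chooseS rP uP (b c) ≡ just s
  same-choice-≤D c uT uP s c≤D sh eqT = same-choice c uT uP s eqT (choice-not-1 (1∈uT sh) eqT) (uP⊆uT sh) (uT⊆uP sh)
    (λ bD<bc → ⊥-elim (<⇒≱ bD<bc (b-mono c≤D D≤m)))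

  used-below : ∀ {c uT s} → chooseS rT uT (b c) ≡ just s → (∀ {y} → y ∈ rT → y < s → y ∈ uT) →
    ∀ {y} → y ∈ rT → y < b c → y ∈ s ∷ uT
  used-below {c} {uT} {s} eqT smaller {y} y∈rT y<bc with y ∈? uT
  ... | yes y∈uT = there y∈uT
  ... | no y∉uT with <-cmp y s
  ...   | tri< y<s _ _ = ⊥-elim (y∉uT (smaller y∈rT y<s))
  ...   | tri≈ _ refl _ = here refl
  ...   | tri> _ _ s<y = ⊥-elim (<⇒≱ s<y (proj₂ (chooseS-just rT uT (b c) s eqT) y (y∈rT , y<bc , y∉uT)))

  -- If T takes the pending entry at column c < D, then a_{c+1} = b_c
  -- (otherwise the unused a_{c+1} would have been a better choice).
  taken-pending⇒a≡b : ∀ c uT z → c < D → UsedBefore c uT → Pending c uT z → chooseS rT uT (b c) ≡ just z → a (suc c) ≡ b c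
  taken-pending⇒a≡b c uT z c<D used pend eqT = ≤-antisym (D-before c c<D) (≮⇒≥ a<b-impossible)
    where
    c<m : c < m
    c<m = <-≤-trans c<D D≤m
    a<b-impossible : a (suc c) < b c → ⊥
    a<b-impossible a<bc with unused-a 0 (suc (suc c)) (z ∷ uT) (s≤s c<m) (s≤s (s≤s (≤-reflexive (length≡ used))))
    ... | j , _ , j<c+2 , aj∉ =
      aj∉ (used-below eqT (smaller-used pend) (rT⁺ j (≤-trans (≤-pred j<c+2) c<m)) (≤-<-trans (a-mono (≤-pred j<c+2) c<m) a<bc))

  -- One column of phase 2: T's choice s either is the pending entry, which is
  -- then replaced by b_c = a_{c+1} (and the new pair links z to b_c), or
  -- leaves the pending entry unchanged.
  phase2-choice : ∀ c uT uP z → c < D → Phase2 c uT uP z →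
    Σ ℕ λ s → Σ ℕ λ z' → chooseS rT uT (b c) ≡ just s × Phase2 (suc c) (s ∷ uT) (s ∷ uP) z' × Gen ((b c , s) ∷ []) z z'
  phase2-choice c uT uP z c<D (used , sh , pend) with chooseS-some rT uT (b c) z (z∈rT pend , z<bc pend , z∉uT pend)
  ... | s , eqT = s , next (chooseS-just rT uT (b c) s eqT) (s ≟ z)
    where
    c<m : c < m
    c<m = <-≤-trans c<D D≤m
    bc<bc+1 : b c < b (suc c)
    bc<bc+1 = b-inc c (suc c) (n<1+n c) c<m

    next : Available rT uT (b c) s × (∀ a → Available rT uT (b c) a → a ≤ s) → Dec (s ≡ z) →
      Σ ℕ λ z' → chooseS rT uT (b c) ≡ just s × Phase2 (suc c) (s ∷ uT) (s ∷ uP) z' × Gen ((b c , s) ∷ []) z z'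
    next ((s∈rT , s<bc , s∉uT) , _) (yes refl) =
      b c , eqT , (use used s∈rT s∉uT s<bc (<⇒≤ c<m) , shadow-use s sh , taken) , gen-sym (gen-edge (here refl))
      where
      taken : Pending (suc c) (s ∷ uT) (b c)
      taken = record
        { z∈rT = subst (_∈ rT) (taken-pending⇒a≡b c uT s c<D used pend eqT) (rT⁺ (suc c) c<m)
        ; z∉uT = λ { (here bc≡s) → <⇒≢ s<bc (sym bc≡s) ; (there p) → <-irrefl refl (below used p (<⇒≤ c<m)) }
        ; smaller-used = used-below eqT (smaller-used pend)
        ; z<bc = bc<bc+1 }
    next ((s∈rT , s<bc , s∉uT) , _) (no s≢z) =
      z , eqT , (use used s∈rT s∉uT s<bc (<⇒≤ c<m) , shadow-use s sh , kept) , gen-refl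
      where
      kept : Pending (suc c) (s ∷ uT) z
      kept = record
        { z∈rT = z∈rT pend
        ; z∉uT = λ { (here z≡s) → s≢z (sym z≡s) ; (there p) → z∉uT pend p }
        ; smaller-used = λ y∈rT y<z → there (smaller-used pend y∈rT y<z)
        ; z<bc = <-trans (z<bc pend) bc<bc+1 }

  left-of-D : ∀ {x} → x ∈ rT → x < b D → x ∈ seg a 0 (suc D)
  left-of-D x∈rT x<bD with rT⁻ x∈rT
  ... | j , j≤m , refl = seg-∈⁺ a 0 (suc D) j z≤n (s≤s (below-column D j≤m x<bD (λ D<m → <⇒≤ (D-at D<m))))

  -- At column D, T takes the pending entry: by pigeonhole on the first D + 1
  -- columns there is no other available entry.  Afterwards phase 3 holds.
  phase2-last : ∀ uT uP z → Phase2 D uT uP z → chooseS rT uT (b D) ≡ just z × Phase3 (suc D) (z ∷ uT) (z ∷ uP)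
  phase2-last uT uP z (used , sh , pend) with chooseS-some rT uT (b D) z (z∈rT pend , z<bc pend , z∉uT pend)
  ... | s , eqT with chooseS-just rT uT (b D) s eqT | s ≟ z
  ... | (s∈rT , s<bD , s∉uT) , _ | no s≢z = ⊥-elim (1+n≰n (subst₂ _≤_ (cong (λ l → suc (suc l)) (length≡ used)) (seg-length a 0 (suc D))
          (pigeonhole (s ∷ z ∷ uT) (seg a 0 (suc D)) ((λ { (here s≡z) → s≢z s≡z ; (there p) → s∉uT p }) , z∉uT pend , distinct used)
             λ { (here refl) → left-of-D s∈rT s<bD ; (there (here refl)) → left-of-D (z∈rT pend) (z<bc pend)
               ; (there (there p)) → left-of-D (⊆rT used p) (below used p D≤m) })))
  ... | _ | yes refl = eqT , use used (z∈rT pend) (z∉uT pend) (z<bc pend) D≤m , shadow-use s sh ,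
          λ y∈rT y≤bD → used-below eqT (smaller-used pend) y∈rT (≤∧≢⇒< y≤bD (bD∉rT y∈rT))

  phase2 : ∀ k c uT uP z → c + k ≡ D → Phase2 c uT uP z →
    Σ (Run c uT uP (seg b c (suc k) ++ restD) (suc D) restD (Phase3 (suc D))) λ r → Gen (common r) z (b D)
  phase2 zero c uT uP z e inv with ≡-of-+0 e
  ... | refl with phase2-last uT uP z inv
  ... | eqT , inv' = run-step z D≤m eqT (same-choice-≤D D uT uP z ≤-refl (proj₁ (proj₂ inv)) eqT) (run-stop inv') ,
                     gen-sym (gen-edge (here refl))
  phase2 (suc k) c uT uP z e inv with phase2-choice c uT uP z (<-of-+suc e) inv
  ... | s , z' , eqT , inv' , link with phase2 k (suc c) (s ∷ uT) (s ∷ uP) z' (trans (sym (+-suc c k)) e) inv'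
  ... | r , chain = run-step s c≤m eqT (same-choice-≤D c uT uP s c≤D (proj₁ (proj₂ inv)) eqT) r ,
                    gen-trans (Gen-mono (λ { (here refl) → here refl }) link) (Gen-mono there chain)
    where
    c≤D : c ≤ D
    c≤D = <⇒≤ (<-of-+suc e)
    c≤m : c ≤ m
    c≤m = ≤-trans c≤D D≤m

  -- One column of phase 3: all entries up to b_D are used, so T's choice
  -- exceeds b_D and P makes the same choice.
  phase3-choice : ∀ c uT uP → c ≤ m → Phase3 c uT uP →
    Σ ℕ λ s → chooseS rT uT (b c) ≡ just s × chooseS rP uP (b c) ≡ just s × Phase3 (suc c) (s ∷ uT) (s ∷ uP)
  phase3-choice c uT uP c≤m (used , sh , low)
    with unused-a 0 (suc c) uT (s≤s c≤m) (subst (_< suc c) (sym (length≡ used)) (n<1+n c))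
  ... | j , _ , j<c+1 , aj∉uT
    with chooseS-some rT uT (b c) (a j) (rT⁺ j (≤-trans (≤-pred j<c+1) c≤m) , <-≤-trans (a<b j) (b-mono (≤-pred j<c+1) c≤m) , aj∉uT)
  ... | s , eqT with chooseS-just rT uT (b c) s eqT
  ... | (s∈rT , s<bc , s∉uT) , _ =
    s , eqT , eqP , use used s∈rT s∉uT s<bc c≤m , shadow-use s sh , λ y∈rT y≤bD → there (low y∈rT y≤bD)
    where
    bD<s : b D < s
    bD<s = ≰⇒> (λ s≤bD → s∉uT (low s∈rT s≤bD))
    eqP : chooseS rP uP (b c) ≡ just s
    eqP = same-choice c uT uP s eqT (choice-not-1 (1∈uT sh) eqT) (uP⊆uT sh) (uT⊆uP sh) (λ _ → <⇒≤ bD<s)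

  phase3 : ∀ k c uT uP → c + k ≡ suc m → Phase3 c uT uP →
    Run c uT uP (seg b c k ++ suc N ∷ []) (suc m) (suc N ∷ []) (Phase3 (suc m))
  phase3 zero c uT uP e inv with ≡-of-+0 e
  ... | refl = run-stop inv
  phase3 (suc k) c uT uP e inv with phase3-choice c uT uP (≤-pred (<-of-+suc e)) inv
  ... | s , eqT , eqP , inv' = run-step s (≤-pred (<-of-+suc e)) eqT eqP (phase3 k (suc c) (s ∷ uT) (s ∷ uP) (trans (sym (+-suc c k)) e) inv')

  phase3-end : ∀ uT uP → Phase3 (suc m) uT uP → pairsGo rT uT (RT (suc m)) ≡ [] × pairsGo rP uP (suc N ∷ []) ≡ (suc N , b D) ∷ []
  phase3-end uT uP (used , sh , _) rewrite n∸n≡0 m = refl , pairsGo-step rP uP (suc N) [] (b D) P-takes-bD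
    where
    P-takes-bD : chooseS rP uP (suc N) ≡ just (b D)
    P-takes-bD = chooseS-max rP uP (suc N) (b D) (bD∈rP , s≤s (b≤N D D≤m) , λ p → bD∉rT (⊆rT used (uP⊆uT sh p)) refl) best
      where
      best : ∀ y → Available rP uP (suc N) y → y ≤ b D
      best y (y∈rP , _ , y∉uP) with rP⁻ y∈rP
      ... | inj₂ refl = ≤-refl
      ... | inj₁ (j , 1≤j , j≤m , refl) = ⊥-elim (y∉uP (uT⊆uP sh (exhausts rT uT (distinct used) (⊆rT used)
              (≤-reflexive (trans (seg-length a 0 (suc m)) (sym (length≡ used)))) (rT⁺ j j≤m)) (a≢1 1≤j j≤m)))

  finish : ∀ {c uT uP bsP} (r : Run c uT uP bsP (suc m) (suc N ∷ []) (Phase3 (suc m))) →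
    pairsGo rT uT (RT c) ≡ common r × pairsGo rP uP bsP ≡ common r ++ (suc N , b D) ∷ []
  finish r with phase3-end (usedT r) (usedP r) (reached r)
  ... | endT , endP = trans (runT r) (trans (cong (common r ++_) endT) (ListProps.++-identityʳ (common r))) ,
                      trans (runP r) (cong (common r ++_) endP)

  AfterE : List ℕ → Set
  AfterE u = Σ (List (ℕ × ℕ)) λ O →
    pairsGo rT (1 ∷ u) (RT (suc E)) ≡ O × pairsGo rP u restE ≡ O ++ (suc N , b D) ∷ [] × Gen O (b E) (b D)

  -- If E < D, then b_E = a_{E+1} is the pending entry starting phase 2.
  phase2-start : ∀ u → E < D → Phase1 E u → Phase2 (suc E) (1 ∷ u) u (b E)
  phase2-start u E<D (used , 1∉u) = use used 1∈rT 1∉u (1<b E≤m) E≤m , shadow-after-1 u , record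
    { z∈rT = subst (_∈ rT) (≤-antisym (D-before E E<D) (E-at E<m)) (rT⁺ (suc E) E<m)
    ; z∉uT = λ { (here bE≡1) → <⇒≢ (1<b E≤m) (sym bE≡1) ; (there p) → <-irrefl refl (below used p E≤m) }
    ; smaller-used = λ y∈rT y<bE → [ (λ { refl → here refl }) , there ]′ (used-up-to-E (used , 1∉u) y∈rT y<bE)
    ; z<bc = b-inc E (suc E) (n<1+n E) E<m }
    where
    E<m : E < m
    E<m = <-≤-trans E<D D≤m

  restE-split : E < D → restE ≡ seg b (suc E) (suc (D ∸ suc E)) ++ restD
  restE-split E<D = begin
    seg b (suc E) (m ∸ E) ++ suc N ∷ []                     ≡⟨ cong (λ l → seg b (suc E) l ++ suc N ∷ []) lengths ⟩
    seg b (suc E) (suc k + (m ∸ D)) ++ suc N ∷ []            ≡⟨ cong (_++ suc N ∷ []) (seg-++ b (suc E) (suc k) (m ∸ D)) ⟩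
    (seg b (suc E) (suc k) ++ seg b (suc E + suc k) (m ∸ D)) ++ suc N ∷ []
      ≡⟨ ListProps.++-assoc (seg b (suc E) (suc k)) _ (suc N ∷ []) ⟩
    seg b (suc E) (suc k) ++ seg b (suc E + suc k) (m ∸ D) ++ suc N ∷ []
      ≡⟨ cong (λ i → seg b (suc E) (suc k) ++ seg b i (m ∸ D) ++ suc N ∷ []) (trans (+-suc (suc E) k) (cong suc E+1+k≡D)) ⟩
    seg b (suc E) (suc k) ++ restD                           ∎
    where
    open ≡-Reasoning
    k : ℕ
    k = D ∸ suc E
    E+1+k≡D : suc E + k ≡ D
    E+1+k≡D = m+[n∸m]≡n E<D
    lengths : m ∸ E ≡ suc k + (m ∸ D)
    lengths = trans (cong (_∸ E) (sym total)) (m+n∸m≡n E (suc k + (m ∸ D)))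
      where
      total : E + (suc k + (m ∸ D)) ≡ m
      total = begin
        E + (suc k + (m ∸ D))  ≡⟨ sym (+-assoc E (suc k) (m ∸ D)) ⟩
        E + suc k + (m ∸ D)    ≡⟨ cong (_+ (m ∸ D)) (trans (+-suc E k) E+1+k≡D) ⟩
        D + (m ∸ D)            ≡⟨ m+[n∸m]≡n D≤m ⟩
        m                      ∎

  after-E-split : ∀ u → E < D → Phase1 E u → AfterE u
  after-E-split u E<D inv with phase2 (D ∸ suc E) (suc E) (1 ∷ u) u (b E) (m+[n∸m]≡n E<D) (phase2-start u E<D inv)
  ... | r₂ , chain with finish (run-then r₂ (phase3 (m ∸ D) (suc D) (usedT r₂) (usedP r₂) (cong suc (m+[n∸m]≡n D≤m)) (reached r₂)))
  ... | endT , endP = _ , endT , trans (cong (pairsGo rP u) (restE-split E<D)) endP , Gen-mono ∈-++⁺ˡ chain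

  -- If E = D, phase 2 is empty: after using 1, all entries up to b_D are used.
  after-E-direct : ∀ u → E ≡ D → Phase1 E u → AfterE u
  after-E-direct u E≡D (used , 1∉u) with phase3 (m ∸ D) (suc D) (1 ∷ u) u (cong suc (m+[n∸m]≡n D≤m)) start
    where
    start : Phase3 (suc D) (1 ∷ u) u
    start = subst (λ c → UsedBefore (suc c) (1 ∷ u)) E≡D (use used 1∈rT 1∉u (1<b E≤m) E≤m) , shadow-after-1 u ,
      λ y∈rT y≤bD → [ (λ { refl → here refl }) , there ]′
        (used-up-to-E (used , 1∉u) y∈rT (subst (λ c → _ < b c) (sym E≡D) (≤∧≢⇒< y≤bD (bD∉rT y∈rT))))
  ... | r₃ with finish r₃
  ... | endT , endP = common r₃ , trans (cong (λ c → pairsGo rT (1 ∷ u) (RT (suc c))) E≡D) endT ,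
                      trans (cong (λ c → pairsGo rP u (seg b (suc c) (m ∸ c) ++ suc N ∷ [])) E≡D) endP ,
                      subst (λ c → Gen (common r₃) (b c) (b D)) (sym E≡D) gen-refl

  record Comparison : Set where
    field
      before after : List (ℕ × ℕ)
      pairsT : pairsGo rT [] (RT 0) ≡ before ++ (b E , 1) ∷ after
      pairsP : pairsGo rP [] (seg b 0 E ++ restE) ≡ before ++ after ++ (suc N , b D) ∷ []
      linked : Gen after (b E) (b D)

  comparison : Comparison
  comparison with phase1 E 0 [] refl (nothing-used , λ ())
  ... | r₁ with reached r₁
  ... | inv , uP≡uT with after-E (usedT r₁) inv
    where
    after-E : ∀ u → Phase1 E u → AfterE u
    after-E u inv with m≤n⇒m<n∨m≡n E≤D
    ... | inj₁ E<D = after-E-split u E<D inv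
    ... | inj₂ E≡D = after-E-direct u E≡D inv
  ... | O , restT , restP , chain = record
    { before = common r₁ ; after = O ; linked = chain
    ; pairsT = trans (runT r₁) (cong (common r₁ ++_) (trans (cong (pairsGo rT (usedT r₁)) (RT-cons E E≤m))
                 (trans (pairsGo-step rT (usedT r₁) (b E) (RT (suc E)) 1 (T-takes-1 inv)) (cong ((b E , 1) ∷_) restT))))
    ; pairsP = trans (runP r₁) (cong (common r₁ ++_) (trans (cong (λ u → pairsGo rP u restE) uP≡uT) restP)) }

rotate : ℕ → ℕ → ℕ
rotate N x = if x ≡ᵇ 1 then N else pred x

rotPre-below : ∀ {N x} → x < N → rotPre N x ≡ suc x
rotPre-below x<N rewrite <⇒<ᵇ-true x<N = refl

rotPre-top : ∀ N → rotPre N N ≡ 1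
rotPre-top N rewrite ≥⇒<ᵇ-false {N} {N} ≤-refl = refl

rotate-suc : ∀ {N v} → 1 ≤ v → rotate N (suc v) ≡ v
rotate-suc {v = suc v} _ = refl

rotate-pred : ∀ {N v} → 2 ≤ v → rotate N v ≡ pred v
rotate-pred (s≤s 1≤v) = rotate-suc 1≤v

rotate-rotPre : ∀ {N i} → 1 ≤ i → i ≤ N → rotate N (rotPre N i) ≡ i
rotate-rotPre {N} {i} 1≤i i≤N with m≤n⇒m<n∨m≡n i≤N
... | inj₁ i<N rewrite rotPre-below i<N = rotate-suc 1≤i
... | inj₂ refl rewrite rotPre-top N = refl

module Rotation (m k : ℕ) (T : Tab (suc m)) (inc : InInc (suc m) k T)
  (D E : ℕ) (br : Breaks m (topRow T) (bottomRow T) D E) where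

  N : ℕ
  N = 2 * suc m ∸ k

  open Rows m N T inc
  open Promotion m N T inc D E br
  open Breaks br
  open IsIncreasingWithMax inc using (positive; bounded)

  maxEntry≡N : maxEntry T ≡ N
  maxEntry≡N = maxEntry-increasing T inc (≤-trans (positive zero zero) (bounded zero zero))

  relabel-labelled : ∀ v → v ≢ 0 → suc (relabel v) ≡ v
  relabel-labelled zero v≢0 = ⊥-elim (v≢0 refl)
  relabel-labelled (suc v) _ = refl

  P-row₁ P-row₂ P-top P-bottom : ℕ → ℕ
  P-row₁ j = relabel (StT n j)
  P-row₂ j = relabel (StB n j)
  P-top j = suc (P-row₁ j)
  P-bottom j = suc (P-row₂ j)

  P-top≡ : ∀ j → j ≤ m → P-top j ≡ StT n j
  P-top≡ j j≤m = relabel-labelled (StT n j) λ z → <⇒≱ (s≤s D≤m) (proj₁ (top-zero n j j≤m z))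

  P-bottom-left : ∀ {j} → j < E → P-bottom j ≡ b j
  P-bottom-left {j} j<E rewrite bottom-left {n} (s≤s E≤m) j<E = relabel-labelled (b j) (b≢0 (≤-trans (<⇒≤ j<E) E≤m))

  P-bottom-shifted : ∀ {j} → E ≤ j → j < m → P-bottom j ≡ b (suc j)
  P-bottom-shifted {j} E≤j j<m rewrite bottom-shifted {n} (s≤s E≤m) E≤j (s≤s j<m) = relabel-labelled (b (suc j)) (b≢0 j<m)

  P-bottom-last : P-bottom m ≡ suc N
  P-bottom-last rewrite bottom-hole {n} {m} (s≤s E≤m) refl = cong suc maxEntry≡N

  rP : List ℕ
  rP = seg (StT n) 0 n

  rP⁻ : ∀ {x} → x ∈ rP → (Σ ℕ λ j → 1 ≤ j × j ≤ m × a j ≡ x) ⊎ x ≡ b D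
  rP⁻ p with seg-∈⁻ (StT n) 0 n p
  ... | j , _ , j<n , refl with <-cmp j D
  ...   | tri< j<D _ _ = inj₁ (suc j , s≤s z≤n , <-≤-trans j<D D≤m , sym (top-shifted⁺ (s≤s D≤m) j<D))
  ...   | tri≈ _ refl _ = inj₂ (top-dropped (s≤s D≤m))
  ...   | tri> _ _ D<j = inj₁ (j , ≤-trans (s≤s z≤n) D<j , ≤-pred j<n , sym (top-unmoved⁺ (s≤s D≤m) D<j))

  rP⁺ : ∀ j → 1 ≤ j → j ≤ m → a j ∈ rP
  rP⁺ (suc j) _ j<m with ≤-<-connex (suc j) D
  ... | inj₁ j<D = subst (_∈ rP) (top-shifted⁺ (s≤s D≤m) j<D) (seg-∈⁺ (StT n) 0 n j z≤n (<-trans (n<1+n j) (s≤s j<m)))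
  ... | inj₂ D≤j = subst (_∈ rP) (top-unmoved⁺ (s≤s D≤m) D≤j) (seg-∈⁺ (StT n) 0 n (suc j) z≤n (s≤s j<m))

  bD∈rP : b D ∈ rP
  bD∈rP = subst (_∈ rP) (top-dropped (s≤s D≤m)) (seg-∈⁺ (StT n) 0 n D z≤n (s≤s D≤m))

  open Pairing m N a b a-inc b-inc a<b a₀≡1 (λ j _ → b≤M j) D E br rP rP⁻ rP⁺ bD∈rP

  P-bottom-row : seg P-bottom 0 n ≡ seg b 0 E ++ restE
  P-bottom-row = begin
    seg P-bottom 0 n                                            ≡⟨ cong (seg P-bottom 0) (sym split) ⟩
    seg P-bottom 0 (E + ((m ∸ E) + 1))                          ≡⟨ seg-++ P-bottom 0 E _ ⟩
    seg P-bottom 0 E ++ seg P-bottom E ((m ∸ E) + 1)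
      ≡⟨ cong (_++ seg P-bottom E ((m ∸ E) + 1)) (seg-cong P-bottom b 0 E (λ j _ j<E → P-bottom-left j<E)) ⟩
    seg b 0 E ++ seg P-bottom E ((m ∸ E) + 1)                   ≡⟨ cong (seg b 0 E ++_) (seg-++ P-bottom E (m ∸ E) 1) ⟩
    seg b 0 E ++ seg P-bottom E (m ∸ E) ++ seg P-bottom (E + (m ∸ E)) 1
      ≡⟨ cong (λ l → seg b 0 E ++ l ++ seg P-bottom (E + (m ∸ E)) 1) (seg-shift P-bottom b E (m ∸ E) shifted) ⟩
    seg b 0 E ++ seg b (suc E) (m ∸ E) ++ seg P-bottom (E + (m ∸ E)) 1
      ≡⟨ cong (λ i → seg b 0 E ++ seg b (suc E) (m ∸ E) ++ P-bottom i ∷ []) (m+[n∸m]≡n E≤m) ⟩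
    seg b 0 E ++ seg b (suc E) (m ∸ E) ++ P-bottom m ∷ []       ≡⟨ cong (λ v → seg b 0 E ++ seg b (suc E) (m ∸ E) ++ v ∷ []) P-bottom-last ⟩
    seg b 0 E ++ restE                                          ∎
    where
    open ≡-Reasoning
    split : E + ((m ∸ E) + 1) ≡ n
    split = trans (sym (+-assoc E (m ∸ E) 1)) (trans (cong (_+ 1) (m+[n∸m]≡n E≤m)) (+-comm m 1))
    shifted : ∀ j → E ≤ j → j < E + (m ∸ E) → P-bottom j ≡ b (suc j)
    shifted j E≤j j<end = P-bottom-shifted E≤j (subst (j <_) (m+[n∸m]≡n E≤m) j<end)

  P-bottom≤N : ∀ {j} → j < m → P-bottom j ≤ N
  P-bottom≤N {j} j<m with ≤-<-connex E j
  ... | inj₁ E≤j = subst (_≤ N) (sym (P-bottom-shifted E≤j j<m)) (b≤M (suc j))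
  ... | inj₂ j<E = subst (_≤ N) (sym (P-bottom-left j<E)) (b≤M j)

  P-bottom-increasing : IncreasingOn P-bottom 0 n
  P-bottom-increasing j j' _ j<j' j'<n with m≤n⇒m<n∨m≡n (≤-pred j'<n)
  ... | inj₂ refl = subst (P-bottom j <_) (sym P-bottom-last) (s≤s (P-bottom≤N j<j'))
  ... | inj₁ j'<m with ≤-<-connex E j | ≤-<-connex E j'
  ...   | inj₁ E≤j | inj₁ E≤j' = subst₂ _<_ (sym (P-bottom-shifted E≤j (<-trans j<j' j'<m))) (sym (P-bottom-shifted E≤j' j'<m))
                                   (b-inc _ _ (s≤s j<j') j'<m)
  ...   | inj₁ E≤j | inj₂ j'<E = ⊥-elim (<⇒≱ (<-trans j<j' j'<E) E≤j)
  ...   | inj₂ j<E | inj₁ E≤j' = subst₂ _<_ (sym (P-bottom-left j<E)) (sym (P-bottom-shifted E≤j' j'<m))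
                                   (b-inc _ _ (<-trans j<j' (n<1+n j')) j'<m)
  ...   | inj₂ j<E | inj₂ j'<E = subst₂ _<_ (sym (P-bottom-left j<E)) (sym (P-bottom-left j'<E)) (b-inc _ _ j<j' (<⇒≤ j'<m))

  pairs-T : piPairs T ≡ pairsGo rT [] (RT 0)
  pairs-T = cong₂ (λ r bs → pairsGo r [] bs) (row-as-seg (T zero) a T-top)
    (trans (cong sortℕ (row-as-seg (T (suc zero)) b T-bottom))
           (sort-increasing b 0 n (λ j j' _ j<j' j'<n → b-inc j j' j<j' (≤-pred j'<n))))

  pairs-P : map shiftPair (piPairs (kPro T)) ≡ pairsGo rP [] (seg b 0 E ++ restE)
  pairs-P = begin
    map shiftPair (pairsGo (row (kPro T) zero) [] (sortℕ (row (kPro T) (suc zero))))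
      ≡⟨ cong₂ (λ r bs → map shiftPair (pairsGo r [] bs)) (row-as-seg (kPro T zero) P-row₁ (kPro-closed-form zero)) bottom-sorted ⟩
    map shiftPair (pairsGo (seg P-row₁ 0 n) [] (seg P-row₂ 0 n))
      ≡⟨ sym (pairsGo-suc (seg P-row₁ 0 n) [] (seg P-row₂ 0 n)) ⟩
    pairsGo (map suc (seg P-row₁ 0 n)) [] (map suc (seg P-row₂ 0 n))
      ≡⟨ cong₂ (λ r bs → pairsGo r [] bs) (trans (seg-map-suc P-row₁ 0 n) (seg-cong P-top (StT n) 0 n (λ j _ j<n → P-top≡ j (≤-pred j<n))))
                                          (trans (seg-map-suc P-row₂ 0 n) P-bottom-row) ⟩
    pairsGo rP [] (seg b 0 E ++ restE)  ∎
    where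
    open ≡-Reasoning
    bottom-sorted : sortℕ (row (kPro T) (suc zero)) ≡ seg P-row₂ 0 n
    bottom-sorted = trans (cong sortℕ (row-as-seg (kPro T (suc zero)) P-row₂ (kPro-closed-form (suc zero))))
      (sort-increasing P-row₂ 0 n (λ j j' 0≤j j<j' j'<n → ≤-pred (P-bottom-increasing j j' 0≤j j<j' j'<n)))

  ET EP : List (ℕ × ℕ)
  ET = piPairs T
  EP = piPairs (kPro T)

  open Comparison comparison

  ET≡ : ET ≡ before ++ (b E , 1) ∷ after
  ET≡ = trans pairs-T pairsT

  EP≡ : map shiftPair EP ≡ before ++ after ++ (suc N , b D) ∷ []
  EP≡ = trans pairs-P pairsP

  shared⇒ET : ∀ {e} → e ∈ before ++ after → e ∈ ET
  shared⇒ET {e} p = subst (e ∈_) (sym ET≡) ([ ∈-++⁺ˡ , (λ q → ∈-++⁺ʳ before (there q)) ]′ (∈-++⁻ before p))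

  ET⇒shared : ∀ {e} → e ∈ ET → e ≡ (b E , 1) ⊎ e ∈ before ++ after
  ET⇒shared {e} p with ∈-++⁻ before (subst (e ∈_) ET≡ p)
  ... | inj₁ q = inj₂ (∈-++⁺ˡ q)
  ... | inj₂ (here q) = inj₁ q
  ... | inj₂ (there q) = inj₂ (∈-++⁺ʳ before q)

  shared⇒EP : ∀ {e} → e ∈ before ++ after → e ∈ map shiftPair EP
  shared⇒EP {e} p = subst (e ∈_) (sym EP≡) ([ ∈-++⁺ˡ , (λ q → ∈-++⁺ʳ before (∈-++⁺ˡ q)) ]′ (∈-++⁻ before p))

  EP⇒shared : ∀ {e} → e ∈ map shiftPair EP → e ∈ before ++ after ⊎ e ≡ (suc N , b D)
  EP⇒shared {e} p with ∈-++⁻ before (subst (e ∈_) EP≡ p)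
  ... | inj₁ q = inj₁ (∈-++⁺ˡ q)
  ... | inj₂ q with ∈-++⁻ after q
  ...   | inj₁ r = inj₁ (∈-++⁺ʳ before r)
  ...   | inj₂ (here r) = inj₂ r

  1~bD : Gen ET 1 (b D)
  1~bD = gen-trans (gen-sym (gen-edge bE1∈ET)) (Gen-mono (λ q → shared⇒ET (∈-++⁺ʳ before q)) linked)
    where
    bE1∈ET : (b E , 1) ∈ ET
    bE1∈ET = subst ((b E , 1) ∈_) (sym ET≡) (∈-++⁺ʳ before (here refl))

  bE~N+1 : Gen (map shiftPair EP) (b E) (suc N)
  bE~N+1 = gen-trans (Gen-mono (λ q → shared⇒EP (∈-++⁺ʳ before q)) linked) (gen-sym (gen-edge last∈EP))
    where
    last∈EP : (suc N , b D) ∈ map shiftPair EP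
    last∈EP = subst ((suc N , b D) ∈_) (sym EP≡) (∈-++⁺ʳ before (∈-++⁺ʳ after (here refl)))

  ET-range : ∀ {x y} → (x , y) ∈ ET → (2 ≤ x × x ≤ N) × y ≤ N
  ET-range p with pairsGo-∈ rT [] (RT 0) (subst (_ ∈_) pairs-T p)
  ... | x∈ , y∈ with seg-∈⁻ b 0 n x∈ | seg-∈⁻ a 0 n y∈
  ... | j , _ , j<n , refl | j' , _ , _ , refl = (≤-<-trans (a-pos j (≤-pred j<n)) (a<b j) , b≤M j) , a≤M j'

  EP-shifted-range : ∀ {x y} → (x , y) ∈ map shiftPair EP → 2 ≤ y
  EP-shifted-range p with rP⁻ (proj₂ (pairsGo-∈ rP [] (seg b 0 E ++ restE) (subst (_ ∈_) pairs-P p)))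
  ... | inj₁ (j , 1≤j , j≤m , refl) = subst (_< a j) a₀≡1 (a-inc 0 j 1≤j j≤m)
  ... | inj₂ refl = ≤-<-trans (a-pos D D≤m) (a<b D)

  rotated-EP-pair : ∀ x y → (x , y) ∈ EP → Gen ET (rotPre N x) (rotPre N y)
  rotated-EP-pair x y p with EP⇒shared (∈-map⁺ shiftPair p)
  ... | inj₁ q with ET-range (shared⇒ET q)
  ...   | (_ , x<N) , y<N rewrite rotPre-below x<N | rotPre-below y<N = gen-edge (shared⇒ET q)
  rotated-EP-pair x y p | inj₂ e = subst₂ (Gen ET) (sym rotPre-x) (sym rotPre-y) 1~bD
    where
    rotPre-x : rotPre N x ≡ 1
    rotPre-x = trans (cong (rotPre N) (suc-injective (cong proj₁ e))) (rotPre-top N)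
    rotPre-y : rotPre N y ≡ b D
    rotPre-y = trans (rotPre-below (subst (_≤ N) (sym (cong proj₂ e)) (b≤M D))) (cong proj₂ e)

  rotated-ET-pair : ∀ x y → (x , y) ∈ ET → Gen EP (rotate N x) (rotate N y)
  rotated-ET-pair x y p with ET⇒shared p
  ... | inj₁ refl = subst (λ v → Gen EP v N) (sym (rotate-pred (proj₁ (proj₁ (ET-range p))))) (Gen-unshift bE~N+1)
  ... | inj₂ q with ∈-map⁻ shiftPair (shared⇒EP q)
  ...   | (x' , y') , q' , refl = subst₂ (Gen EP) (sym (rotate-pred (proj₁ (proj₁ (ET-range p)))))
                                   (sym (rotate-pred (EP-shifted-range (shared⇒EP q)))) (gen-edge q')

  rotation : SamePartition N (piMap (kPro T)) (rotR N (piMap T))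
  rotation i j 1≤i i≤N 1≤j j≤N = mk⇔ (Gen-map (rotPre N) rotated-EP-pair)
    (λ g → subst₂ (Gen EP) (rotate-rotPre 1≤i i≤N) (rotate-rotPre 1≤j j≤N) (Gen-map (rotate N) rotated-ET-pair g))


lemma6p2 : (n k : ℕ) → 1 ≤ n → k ≤ n ∸ 1 → (T : Tab n) → InInc n k T →
    SamePartition (2 * n ∸ k) (piMap (kPro T)) (rotR (2 * n ∸ k) (piMap T))
lemma6p2 zero k () _ T inc
lemma6p2 (suc m) k _ _ T inc with breaks m (topRow T) (bottomRow T)
... | D , E , br = Rotation.rotation m k T inc D E br
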